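{- Let $n\geq 4$, let $G_n=\mathbb{Z}_n\times\mathbb{Z}_n$, let $S=\{(i,0),(0,i),(i,i): 1\leq i\leq n-1\}\subset G_n$, and let $\Gamma(n)=\mathrm{Cay}(G_n;S)$ be the Cayley graph with vertex set $G_n$ in which $g\sim h$ iff $h-g\in S$. Then $$\mathrm{Aut}(\Gamma(n))\cong (\mathbb{Z}_n\times\mathbb{Z}_n)\rtimes(\mathbb{Z}_n^*\times \mathrm{Sym}(3)).$$
   Context: $\mathbb{Z}_n^*$ denotes the group of units of the ring $\mathbb{Z}_n$, and $\mathrm{Sym}(3)$ the symmetric group on 3 letters. -}

module Defs where

open import Data.Nat using (ℕ; zero; suc; _+_; _*_; _∸_; _%_; NonZero; _≤_)
open import Data.Nat.Properties using (*-comm; *-assoc; *-identityʳ)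
open import Data.Nat.DivMod using (_mod_; %-distribˡ-*)
open import Data.Fin using (Fin; toℕ; fromℕ<)
open import Data.Fin.Properties using (toℕ-fromℕ<)
open import Data.Fin.Permutation using (Permutation′; _⟨$⟩ʳ_; _∘ₚ_)
open import Data.Product using (Σ; ∃; _×_; _,_; proj₁; proj₂)
open import Data.Sum using (_⊎_)
open import Relation.Nullary using (¬_)
open import Relation.Binary.PropositionalEquality
  using (_≡_; refl; sym; trans; cong; cong₂; module ≡-Reasoning)

module _ (n : ℕ) .{{_ : NonZero n}} where

  Zn : Set
  Zn = Fin n

  0ₙ 1ₙ : Zn
  0ₙ = 0 mod n
  1ₙ = 1 mod n

  infixl 6 _+ₙ_ _-ₙ_
  infixl 7 _·ₙ_

  _+ₙ_ _·ₙ_ _-ₙ_ : Zn → Zn → Zn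
  a +ₙ b = (toℕ a + toℕ b) mod n
  a ·ₙ b = (toℕ a * toℕ b) mod n
  a -ₙ b = (toℕ a + (n ∸ toℕ b)) mod n

  -ₙ_ : Zn → Zn
  -ₙ a = 0ₙ -ₙ a

  Gn : Set
  Gn = Zn × Zn

  _⊕_ _⊖_ : Gn → Gn → Gn
  (a , b) ⊕ (c , d) = (a +ₙ c , b +ₙ d)
  (a , b) ⊖ (c , d) = (a -ₙ c , b -ₙ d)

  InS : Gn → Set
  InS x = Σ Zn λ i → (1 ≤ toℕ i) ×
            ((x ≡ (i , 0ₙ)) ⊎ (x ≡ (0ₙ , i)) ⊎ (x ≡ (i , i)))

  Adj : Gn → Gn → Set
  Adj g h = InS (h ⊖ g)

  record Aut : Set where
    field
      fun     : Gn → Gn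
      inv     : Gn → Gn
      inv-l   : ∀ x → inv (fun x) ≡ x
      inv-r   : ∀ x → fun (inv x) ≡ x
      adj-to  : ∀ g h → Adj g h → Adj (fun g) (fun h)
      adj-from : ∀ g h → Adj (fun g) (fun h) → Adj g h
  open Aut public

  _≈Aut_ : Aut → Aut → Set
  φ ≈Aut ψ = ∀ x → fun φ x ≡ fun ψ x

  Unit : Set
  Unit = Σ Zn λ u → Σ Zn λ v → u ·ₙ v ≡ 1ₙ

  private
    toℕ-mod : ∀ k → toℕ (k mod n) ≡ k % n
    toℕ-mod k = toℕ-fromℕ< _

    mod-cong : ∀ {a b} → a % n ≡ b % n → a mod n ≡ b mod n
    mod-cong {a} {b} e = Data.Fin.Properties.toℕ-injective
      (trans (toℕ-mod a) (trans e (sym (toℕ-mod b))))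

    mulˡ : ∀ u {x y} → x % n ≡ y % n → (u * x) % n ≡ (u * y) % n
    mulˡ u {x} {y} e = trans (%-distribˡ-* u x n)
      (trans (cong (λ t → ((u % n) * t) % n) e) (sym (%-distribˡ-* u y n)))

    unit-eq : ∀ {u v} → u ·ₙ v ≡ 1ₙ → (toℕ u * toℕ v) % n ≡ 1 % n
    unit-eq {u} {v} e = trans (sym (toℕ-mod _)) (trans (cong toℕ e) (toℕ-mod 1))

    unit-mul : ∀ u u' v v' → u ·ₙ v ≡ 1ₙ → u' ·ₙ v' ≡ 1ₙ →
               (u ·ₙ u') ·ₙ (v' ·ₙ v) ≡ 1ₙ
    unit-mul u u' v v' e e' = mod-cong (begin
        (toℕ ((U * U') mod n) * toℕ ((V' * V) mod n)) % n
          ≡⟨ cong₂ (λ p q → (p * q) % n) (toℕ-mod (U * U')) (toℕ-mod (V' * V)) ⟩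
        (((U * U') % n) * ((V' * V) % n)) % n
          ≡⟨ sym (%-distribˡ-* (U * U') (V' * V) n) ⟩
        ((U * U') * (V' * V)) % n
          ≡⟨ cong (_% n) (*-assoc U U' (V' * V)) ⟩
        (U * (U' * (V' * V))) % n
          ≡⟨ cong (λ t → (U * t) % n) (sym (*-assoc U' V' V)) ⟩
        (U * ((U' * V') * V)) % n
          ≡⟨ cong (λ t → (U * t) % n) (*-comm (U' * V') V) ⟩
        (U * (V * (U' * V'))) % n
          ≡⟨ cong (_% n) (sym (*-assoc U V (U' * V'))) ⟩
        ((U * V) * (U' * V')) % n
          ≡⟨ mulˡ (U * V) (unit-eq {u'} {v'} e') ⟩
        ((U * V) * 1) % n
          ≡⟨ cong (_% n) (*-identityʳ (U * V)) ⟩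
        (U * V) % n
          ≡⟨ unit-eq {u} {v} e ⟩
        1 % n ∎)
      where
        open ≡-Reasoning
        U = toℕ u ; U' = toℕ u' ; V = toℕ v ; V' = toℕ v'

  _·ᵤ_ : Unit → Unit → Unit
  (u , v , e) ·ᵤ (u' , v' , e') = (u ·ₙ u' , v' ·ₙ v , unit-mul u u' v v' e e')

  -- Sym(3) acts by permuting the three vectors v₀ = (1,0), v₁ = (0,1),
  -- v₂ = (-1,-1) (with v₀ + v₁ + v₂ = 0), i.e. permuting the three
  -- cyclic subgroups ⟨(1,0)⟩, ⟨(0,1)⟩, ⟨(1,1)⟩ whose nonzero elements form S;
  -- Z_n^* acts by scalar multiplication.

  Sym3 : Set
  Sym3 = Permutation′ 3

  -- group law on Sym(3): (σ ∘ τ)(i) = σ (τ i)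
  _∘₃_ : Sym3 → Sym3 → Sym3
  σ ∘₃ τ = τ ∘ₚ σ

  vec : Fin 3 → Gn
  vec Fin.zero = (1ₙ , 0ₙ)
  vec (Fin.suc Fin.zero) = (0ₙ , 1ₙ)
  vec (Fin.suc (Fin.suc Fin.zero)) = (-ₙ 1ₙ , -ₙ 1ₙ)

  scale : Zn → Gn → Gn
  scale c (a , b) = (c ·ₙ a , c ·ₙ b)

  permAct : Sym3 → Gn → Gn
  permAct σ (a , b) = scale a (vec (σ ⟨$⟩ʳ Fin.zero)) ⊕ scale b (vec (σ ⟨$⟩ʳ Fin.suc Fin.zero))

  H : Set
  H = Unit × Sym3

  _·H_ : H → H → H
  (u , σ) ·H (u' , σ') = (u ·ᵤ u' , σ ∘₃ σ')

  act : H → Gn → Gn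
  act (u , σ) x = scale (proj₁ u) (permAct σ x)

  SemiDirect : Set
  SemiDirect = Gn × H

  _·SD_ : SemiDirect → SemiDirect → SemiDirect
  (t , h) ·SD (t' , h') = (t ⊕ act h t' , h ·H h')

  _≈SD_ : SemiDirect → SemiDirect → Set
  (t , (u , σ)) ≈SD (t' , (u' , σ')) =
    (t ≡ t') × (proj₁ u ≡ proj₁ u') × (∀ i → σ ⟨$⟩ʳ i ≡ σ' ⟨$⟩ʳ i)

  record IsGroupIso (φ : SemiDirect → Aut) : Set where
    field
      cong-φ    : ∀ x y → x ≈SD y → φ x ≈Aut φ y
      injective : ∀ x y → φ x ≈Aut φ y → x ≈SD y
      surjective : ∀ (f : Aut) → Σ SemiDirect λ x → φ x ≈Aut f
      homo      : ∀ x y → ∀ g → fun (φ (x ·SD y)) g ≡ fun (φ x) (fun (φ y) g)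

  Aut≅SemiDirect : Set
  Aut≅SemiDirect = Σ (SemiDirect → Aut) IsGroupIso

{-# OPTIONS --safe #-}
module Submission where

-- With ℓ₀ (a , b) = b, ℓ₁ (a , b) = a and ℓ₂ (a , b) = a - b, two distinct vertices are adjacent
-- iff some ℓ t agrees on them: Γ(n) is the union of three parallel classes of lines, and lines of
-- different classes meet exactly once. Hence the affine maps x ↦ t + u · σ x, with u a unit and σ
-- permuting the directions (1,0), (0,1), (-1,-1), are automorphisms, and distinct ones differ.
-- Conversely, the common neighbours of an edge x, x + v t are the other points of its line and two
-- "corners". For n ≥ 4, x, x + v t and a further point of the line have a common neighbour (a
-- fourth point of the line), while together with a corner they have none: the corners are adjacent
-- neither to the points of the line nor, as 2 ≢ 0, to each other. This recognises lines in the
-- graph, so every automorphism f maps lines to lines. The induced permutation of the classes is the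
-- same at every point, as one sees by comparing a triangle with its image; so after a translation
-- and that permutation f fixes 0 and every class, which forces it to be multiplication by a unit.

open import Defs
open import Algebra.Bundles using (CommutativeRing)
open import Algebra.Consequences.Propositional
  using (comm∧idˡ⇒idʳ; comm∧invʳ⇒invˡ; comm∧distrˡ⇒distrʳ)
import Algebra.Properties.Ring as RingProperties
import Algebra.Solver.Ring.AlmostCommutativeRing as ACR
open import Algebra.Structures using (IsCommutativeRing)
open import Data.Empty using (⊥; ⊥-elim)
open import Data.Fin as Fin using (Fin; toℕ; punchOut)
open import Data.Fin.Patterns using (0F; 1F; 2F)
open import Data.Fin.Permutation
  using (Permutation′; permutation; _⟨$⟩ʳ_; _⟨$⟩ˡ_; inverseˡ; inverseʳ; flip)
open import Data.Fin.Properties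
  using ( toℕ-fromℕ<; toℕ-injective; toℕ<n; any?; all?; ¬∀⟶∃¬; pigeonhole; injective⇒≤
        ; punchOut-injective; inject≤-injective)
open import Data.Integer as ℤ using (ℤ)
import Data.Integer.Properties as ℤ
open import Data.Maybe using (map)
open import Data.Nat as ℕ using (ℕ; zero; suc; NonZero; _%_; _≤_; _<_; z≤n; s≤s)
open import Data.Nat.DivMod
  using (_mod_; %-distribˡ-+; %-distribˡ-*; m%n%n≡m%n; m<n⇒m%n≡m; n%n≡0; m*n%n≡0)
import Data.Nat.Properties as ℕ
open import Data.Product using (Σ; ∃; ∃₂; _×_; _,_; proj₁; proj₂; map₂)
open import Data.Product.Properties using (≡-dec)
open import Data.Sign as Sign using (Sign)
open import Data.Sum using (_⊎_; inj₁; inj₂)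
open import Function using (_∘_; _⇔_; mk⇔; Equivalence; Injective)
open import Relation.Binary.Definitions using (DecidableEquality)
open import Relation.Binary.PropositionalEquality hiding ([_])
open import Relation.Nullary using (Dec; yes; no; ¬_; ¬?)
open import Relation.Nullary.Decidable using (dec⇒maybe; decidable-stable)

open ≡-Reasoning

-- The element of Fin 3 other than a and b (junk, 0F, when a ≡ b).
third : Fin 3 → Fin 3 → Fin 3
third 0F 1F = 2F
third 1F 0F = 2F
third 0F 2F = 1F
third 2F 0F = 1F
third 1F 2F = 0F
third 2F 1F = 0F
third _  _  = 0F

third-≢ˡ : ∀ {a b} → a ≢ b → third a b ≢ a
third-≢ˡ {0F} {0F} a≢b = ⊥-elim (a≢b refl)
third-≢ˡ {1F} {1F} a≢b = ⊥-elim (a≢b refl)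
third-≢ˡ {2F} {2F} a≢b = ⊥-elim (a≢b refl)
third-≢ˡ {0F} {1F} _ ()
third-≢ˡ {0F} {2F} _ ()
third-≢ˡ {1F} {0F} _ ()
third-≢ˡ {1F} {2F} _ ()
third-≢ˡ {2F} {0F} _ ()
third-≢ˡ {2F} {1F} _ ()

third-comm : ∀ a b → third a b ≡ third b a
third-comm 0F 0F = refl
third-comm 0F 1F = refl
third-comm 0F 2F = refl
third-comm 1F 0F = refl
third-comm 1F 1F = refl
third-comm 1F 2F = refl
third-comm 2F 0F = refl
third-comm 2F 1F = refl
third-comm 2F 2F = refl

third-≢ʳ : ∀ {a b} → a ≢ b → third a b ≢ b
third-≢ʳ {a} {b} a≢b rewrite third-comm a b = third-≢ˡ (a≢b ∘ sym)

≡third : ∀ {a b c} → a ≢ b → c ≢ a → c ≢ b → c ≡ third a b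
≡third {0F} {1F} {2F} _ _ _ = refl
≡third {0F} {2F} {1F} _ _ _ = refl
≡third {1F} {0F} {2F} _ _ _ = refl
≡third {1F} {2F} {0F} _ _ _ = refl
≡third {2F} {0F} {1F} _ _ _ = refl
≡third {2F} {1F} {0F} _ _ _ = refl
≡third {0F} {0F} a≢b _ _ = ⊥-elim (a≢b refl)
≡third {1F} {1F} a≢b _ _ = ⊥-elim (a≢b refl)
≡third {2F} {2F} a≢b _ _ = ⊥-elim (a≢b refl)
≡third {0F} {_} {0F} _ c≢a _ = ⊥-elim (c≢a refl)
≡third {1F} {_} {1F} _ c≢a _ = ⊥-elim (c≢a refl)
≡third {2F} {_} {2F} _ c≢a _ = ⊥-elim (c≢a refl)
≡third {_} {0F} {0F} _ _ c≢b = ⊥-elim (c≢b refl)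
≡third {_} {1F} {1F} _ _ c≢b = ⊥-elim (c≢b refl)
≡third {_} {2F} {2F} _ _ c≢b = ⊥-elim (c≢b refl)

third-cases : ∀ {a b} → a ≢ b → ∀ c → c ≡ a ⊎ c ≡ b ⊎ c ≡ third a b
third-cases {a} {b} a≢b c with c Fin.≟ a | c Fin.≟ b
... | yes c≡a | _        = inj₁ c≡a
... | no _    | yes c≡b  = inj₂ (inj₁ c≡b)
... | no c≢a  | no c≢b   = inj₂ (inj₂ (≡third a≢b c≢a c≢b))

third-involutive : ∀ {a b} → a ≢ b → third a (third a b) ≡ b
third-involutive a≢b = sym (≡third (third-≢ˡ a≢b ∘ sym) (a≢b ∘ sym) (third-≢ʳ a≢b ∘ sym))

third-injective : ∀ {p : Fin 3 → Fin 3} → Injective _≡_ _≡_ p →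
                  ∀ {a b} → a ≢ b → p (third a b) ≡ third (p a) (p b)
third-injective p-inj a≢b =
  ≡third (a≢b ∘ p-inj) (third-≢ˡ a≢b ∘ p-inj) (third-≢ʳ a≢b ∘ p-inj)

module _ {A : Set} (_≟_ : DecidableEquality A) where

  injective⇒avoids : ∀ {m} (p : Fin (suc m) → A) → Injective _≡_ _≡_ p →
                     (q : Fin m → A) → ∃ λ i → ∀ j → p i ≢ q j
  injective⇒avoids {m} p p-inj q with any? (λ i → all? (λ j → ¬? (p i ≟ q j)))
  ... | yes found = found
  ... | no none = ⊥-elim (collision (pigeonhole (ℕ.n<1+n m) (proj₁ ∘ hit)))
    where
    hit : ∀ i → ∃ λ j → p i ≡ q j
    hit i = map₂ (λ {j} → decidable-stable (p i ≟ q j))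
                 (¬∀⟶∃¬ m _ (λ j → ¬? (p i ≟ q j)) (none ∘ (i ,_)))
    collision : (∃₂ λ i i′ → i Fin.< i′ × proj₁ (hit i) ≡ proj₁ (hit i′)) → ⊥
    collision (i , i′ , i<i′ , same) = ℕ.<-irrefl
      (cong toℕ (p-inj (trans (proj₂ (hit i)) (trans (cong q same) (sym (proj₂ (hit i′))))))) i<i′

injective⇒surjective : ∀ {m} (f : Fin m → Fin m) → Injective _≡_ _≡_ f → ∀ y → ∃ λ x → f x ≡ y
injective⇒surjective {suc m} f f-inj y with any? (λ x → f x Fin.≟ y)
... | yes found = found
... | no missed = ⊥-elim (ℕ.<-irrefl refl (injective⇒≤ punched-injective))
  where
  punched : Fin (suc m) → Fin m
  punched x = punchOut {i = y} {j = f x} (missed ∘ (x ,_) ∘ sym)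
  punched-injective : Injective _≡_ _≡_ punched
  punched-injective eq = f-inj (punchOut-injective {i = y} _ _ eq)

injective⇒permutation : ∀ {m} (f : Fin m → Fin m) → Injective _≡_ _≡_ f →
                        Σ (Permutation′ m) λ σ → ∀ i → σ ⟨$⟩ʳ i ≡ f i
injective⇒permutation f f-inj =
  permutation f (proj₁ ∘ surj) (proj₂ ∘ surj) (λ x → f-inj (proj₂ (surj (f x)))) , λ _ → refl
  where
  surj : ∀ y → ∃ λ x → f x ≡ y
  surj = injective⇒surjective f f-inj

module _ (n : ℕ) .{{_ : NonZero n}} where

  -- The ring ℤₙ

  infixl 6 _+_
  infixl 7 _*_
  infix  8 -_

  _+_ _*_ : Zn n → Zn n → Zn n
  _+_ = _+ₙ_ n
  _*_ = _·ₙ_ n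

  -_ : Zn n → Zn n
  -_ = -ₙ_ n

  0# 1# : Zn n
  0# = 0ₙ n
  1# = 1ₙ n

  [_] : ℕ → Zn n
  [ k ] = k mod n

  private
    _≡ₘ_ : ℕ → ℕ → Set
    i ≡ₘ j = i % n ≡ j % n

    +-congₘ : ∀ {i i′ j j′} → i ≡ₘ i′ → j ≡ₘ j′ → (i ℕ.+ j) ≡ₘ (i′ ℕ.+ j′)
    +-congₘ {i} {i′} {j} {j′} p q = trans (%-distribˡ-+ i j n)
      (trans (cong₂ (λ a b → (a ℕ.+ b) % n) p q) (sym (%-distribˡ-+ i′ j′ n)))

    *-congₘ : ∀ {i i′ j j′} → i ≡ₘ i′ → j ≡ₘ j′ → (i ℕ.* j) ≡ₘ (i′ ℕ.* j′)
    *-congₘ {i} {i′} {j} {j′} p q = trans (%-distribˡ-* i j n)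
      (trans (cong₂ (λ a b → (a ℕ.* b) % n) p q) (sym (%-distribˡ-* i′ j′ n)))

    toℕ-[] : ∀ k → toℕ [ k ] ≡ₘ k
    toℕ-[] k = trans (cong (_% n) (toℕ-fromℕ< _)) (m%n%n≡m%n k n)

    ≡ₘ⇒≡ : ∀ {a b : Zn n} → toℕ a ≡ₘ toℕ b → a ≡ b
    ≡ₘ⇒≡ {a} {b} eq = toℕ-injective
      (trans (sym (m<n⇒m%n≡m (toℕ<n a))) (trans eq (m<n⇒m%n≡m (toℕ<n b))))

    toℕ-0# : toℕ 0# ≡ 0
    toℕ-0# = trans (toℕ-fromℕ< _) (m*n%n≡0 0 n)

    toℕ-+ : ∀ a b → toℕ (a + b) ≡ₘ (toℕ a ℕ.+ toℕ b)
    toℕ-+ a b = toℕ-[] _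

    toℕ-* : ∀ a b → toℕ (a * b) ≡ₘ (toℕ a ℕ.* toℕ b)
    toℕ-* a b = toℕ-[] _

    toℕ-neg : ∀ a → toℕ (- a) ≡ₘ (n ℕ.∸ toℕ a)
    toℕ-neg a = trans (toℕ-[] _) (cong (λ z → (z ℕ.+ (n ℕ.∸ toℕ a)) % n) toℕ-0#)

  +-assoc : ∀ a b c → (a + b) + c ≡ a + (b + c)
  +-assoc a b c = ≡ₘ⇒≡ (begin
    toℕ (a + b + c) % n           ≡⟨ trans (toℕ-+ (a + b) c) (+-congₘ (toℕ-+ a b) refl) ⟩
    (A ℕ.+ B ℕ.+ C) % n           ≡⟨ cong (_% n) (ℕ.+-assoc A B C) ⟩
    (A ℕ.+ (B ℕ.+ C)) % n         ≡⟨ trans (toℕ-+ a (b + c)) (+-congₘ refl (toℕ-+ b c)) ⟨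
    toℕ (a + (b + c)) % n         ∎)
    where A = toℕ a; B = toℕ b; C = toℕ c

  +-comm : ∀ a b → a + b ≡ b + a
  +-comm a b = cong [_] (ℕ.+-comm (toℕ a) (toℕ b))

  +-identityˡ : ∀ a → 0# + a ≡ a
  +-identityˡ a = ≡ₘ⇒≡ (trans (toℕ-+ 0# a) (cong (λ z → (z ℕ.+ toℕ a) % n) toℕ-0#))

  -‿inverseʳ : ∀ a → a + - a ≡ 0#
  -‿inverseʳ a = ≡ₘ⇒≡ (begin
    toℕ (a + - a) % n               ≡⟨ trans (toℕ-+ a (- a)) (+-congₘ refl (toℕ-neg a)) ⟩
    (toℕ a ℕ.+ (n ℕ.∸ toℕ a)) % n   ≡⟨ cong (_% n) (ℕ.m+[n∸m]≡n (ℕ.<⇒≤ (toℕ<n a))) ⟩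
    n % n                           ≡⟨ n%n≡0 n ⟩
    0                               ≡⟨ trans (cong (_% n) toℕ-0#) (m*n%n≡0 0 n) ⟨
    toℕ 0# % n                      ∎)

  *-assoc : ∀ a b c → (a * b) * c ≡ a * (b * c)
  *-assoc a b c = ≡ₘ⇒≡ (begin
    toℕ (a * b * c) % n           ≡⟨ trans (toℕ-* (a * b) c) (*-congₘ (toℕ-* a b) refl) ⟩
    (A ℕ.* B ℕ.* C) % n           ≡⟨ cong (_% n) (ℕ.*-assoc A B C) ⟩
    (A ℕ.* (B ℕ.* C)) % n         ≡⟨ trans (toℕ-* a (b * c)) (*-congₘ {A} refl (toℕ-* b c)) ⟨
    toℕ (a * (b * c)) % n         ∎)
    where A = toℕ a; B = toℕ b; C = toℕ c

  *-comm : ∀ a b → a * b ≡ b * a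
  *-comm a b = cong [_] (ℕ.*-comm (toℕ a) (toℕ b))

  *-identityˡ : ∀ a → 1# * a ≡ a
  *-identityˡ a = ≡ₘ⇒≡ (trans (toℕ-* 1# a)
    (trans (*-congₘ (toℕ-[] 1) refl) (cong (_% n) (ℕ.*-identityˡ (toℕ a)))))

  *-distribˡ-+ : ∀ a b c → a * (b + c) ≡ a * b + a * c
  *-distribˡ-+ a b c = ≡ₘ⇒≡ (begin
    toℕ (a * (b + c)) % n         ≡⟨ trans (toℕ-* a (b + c)) (*-congₘ {A} refl (toℕ-+ b c)) ⟩
    (A ℕ.* (B ℕ.+ C)) % n         ≡⟨ cong (_% n) (ℕ.*-distribˡ-+ A B C) ⟩
    (A ℕ.* B ℕ.+ A ℕ.* C) % n     ≡⟨ trans (toℕ-+ (a * b) (a * c))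
                                           (+-congₘ (toℕ-* a b) (toℕ-* a c)) ⟨
    toℕ (a * b + a * c) % n       ∎)
    where A = toℕ a; B = toℕ b; C = toℕ c

  isCommutativeRing : IsCommutativeRing _≡_ _+_ _*_ -_ 0# 1#
  isCommutativeRing = record
    { isRing = record
      { +-isAbelianGroup = record
        { isGroup = record
          { isMonoid = record
            { isSemigroup = record
              { isMagma = record { isEquivalence = isEquivalence ; ∙-cong = cong₂ _+_ }
              ; assoc = +-assoc }
            ; identity = +-identityˡ , comm∧idˡ⇒idʳ +-comm +-identityˡ }
          ; inverse = comm∧invʳ⇒invˡ +-comm -‿inverseʳ , -‿inverseʳ
          ; ⁻¹-cong = cong -_ }
        ; comm = +-comm }
      ; *-cong = cong₂ _*_
      ; *-assoc = *-assoc
      ; *-identity = *-identityˡ , comm∧idˡ⇒idʳ *-comm *-identityˡ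
      ; distrib = *-distribˡ-+ , comm∧distrˡ⇒distrʳ *-comm *-distribˡ-+ }
    ; *-comm = *-comm }

  ℤₙ : CommutativeRing _ _
  ℤₙ = record { isCommutativeRing = isCommutativeRing }

  open CommutativeRing ℤₙ using (zeroˡ; zeroʳ; +-identityʳ; *-identityʳ)
  open RingProperties (CommutativeRing.ring ℤₙ)
    using ( -0#≈0#; -‿involutive; -‿injective; -‿anti-homo-+; -‿+-comm; -‿distribˡ-*; -‿distribʳ-*
          ; -1*x≈-x; +-cancelˡ; +-cancelʳ; x∙y⁻¹≈ε⇒x≈y; x≈y⇒x∙y⁻¹≈ε)

  [+] : ∀ i j → [ i ℕ.+ j ] ≡ [ i ] + [ j ]
  [+] i j = ≡ₘ⇒≡ (trans (toℕ-[] (i ℕ.+ j))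
    (sym (trans (toℕ-+ [ i ] [ j ]) (+-congₘ (toℕ-[] i) (toℕ-[] j)))))

  [*] : ∀ i j → [ i ℕ.* j ] ≡ [ i ] * [ j ]
  [*] i j = ≡ₘ⇒≡ (trans (toℕ-[] (i ℕ.* j))
    (sym (trans (toℕ-* [ i ] [ j ]) (*-congₘ (toℕ-[] i) (toℕ-[] j)))))

  fromℤ : ℤ → Zn n
  fromℤ (ℤ.+ k)     = [ k ]
  fromℤ ℤ.-[1+ k ]  = - [ suc k ]

  private
    [suc] : ∀ i → [ i ] + 1# ≡ [ suc i ]
    [suc] i = trans (sym ([+] i 1)) (cong [_] (ℕ.+-comm i 1))

    fromℤ-neg : ∀ x → fromℤ (ℤ.- x) ≡ - fromℤ x
    fromℤ-neg (ℤ.+ zero)   = sym -0#≈0#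
    fromℤ-neg (ℤ.+ suc k)  = refl
    fromℤ-neg ℤ.-[1+ k ]   = sym (-‿involutive _)

    fromℤ-⊖ : ∀ i j → fromℤ (i ℤ.⊖ j) ≡ [ i ] + - [ j ]
    fromℤ-⊖ zero j = begin
      fromℤ (0 ℤ.⊖ j)       ≡⟨ cong fromℤ (ℤ.⊖-≤ {0} {j} z≤n) ⟩
      fromℤ (ℤ.- (ℤ.+ j))     ≡⟨ fromℤ-neg (ℤ.+ j) ⟩
      - [ j ]               ≡⟨ +-identityˡ (- [ j ]) ⟨
      0# + - [ j ]          ∎
    fromℤ-⊖ (suc i) zero = begin
      fromℤ (suc i ℤ.⊖ 0)   ≡⟨ cong fromℤ (ℤ.⊖-≥ {suc i} {0} z≤n) ⟩
      [ suc i ]             ≡⟨ +-identityʳ [ suc i ] ⟨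
      [ suc i ] + 0#        ≡⟨ cong ([ suc i ] +_) -0#≈0# ⟨
      [ suc i ] + - 0#      ∎
    fromℤ-⊖ (suc i) (suc j) = begin
      fromℤ (suc i ℤ.⊖ suc j)          ≡⟨ cong fromℤ (ℤ.[1+m]⊖[1+n]≡m⊖n i j) ⟩
      fromℤ (i ℤ.⊖ j)                  ≡⟨ fromℤ-⊖ i j ⟩
      [ i ] + - [ j ]                  ≡⟨ cong ([ i ] +_) (+-identityˡ (- [ j ])) ⟨
      [ i ] + (0# + - [ j ])           ≡⟨ cong (λ z → [ i ] + (z + - [ j ])) (-‿inverseʳ 1#) ⟨
      [ i ] + ((1# + - 1#) + - [ j ])  ≡⟨ cong ([ i ] +_) (+-assoc 1# (- 1#) (- [ j ])) ⟩
      [ i ] + (1# + (- 1# + - [ j ]))  ≡⟨ +-assoc [ i ] 1# _ ⟨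
      ([ i ] + 1#) + (- 1# + - [ j ])  ≡⟨ cong (([ i ] + 1#) +_) (-‿anti-homo-+ [ j ] 1#) ⟨
      ([ i ] + 1#) + - ([ j ] + 1#)    ≡⟨ cong₂ (λ a b → a + - b) ([suc] i) ([suc] j) ⟩
      [ suc i ] + - [ suc j ]          ∎

    fromℤ-+ : ∀ x y → fromℤ (x ℤ.+ y) ≡ fromℤ x + fromℤ y
    fromℤ-+ ℤ.-[1+ i ] ℤ.-[1+ j ] = begin
      - [ suc (suc (i ℕ.+ j)) ]       ≡⟨ cong (λ k → - [ suc k ]) (ℕ.+-suc i j) ⟨
      - [ suc i ℕ.+ suc j ]           ≡⟨ cong -_ ([+] (suc i) (suc j)) ⟩
      - ([ suc i ] + [ suc j ])       ≡⟨ -‿+-comm [ suc i ] [ suc j ] ⟨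
      - [ suc i ] + - [ suc j ]       ∎
    fromℤ-+ ℤ.-[1+ i ] (ℤ.+ j)   = trans (fromℤ-⊖ j (suc i)) (+-comm [ j ] (- [ suc i ]))
    fromℤ-+ (ℤ.+ i) ℤ.-[1+ j ]   = fromℤ-⊖ i (suc j)
    fromℤ-+ (ℤ.+ i) (ℤ.+ j)      = [+] i j

    signed : Sign → Zn n → Zn n
    signed Sign.+ a = a
    signed Sign.- a = - a

    fromℤ-◃ : ∀ s k → fromℤ (s ℤ.◃ k) ≡ signed s [ k ]
    fromℤ-◃ Sign.+ zero     = refl
    fromℤ-◃ Sign.- zero     = sym -0#≈0#
    fromℤ-◃ Sign.+ (suc k)  = refl
    fromℤ-◃ Sign.- (suc k)  = refl

    fromℤ-signed : ∀ x → fromℤ x ≡ signed (ℤ.sign x) [ ℤ.∣ x ∣ ]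
    fromℤ-signed (ℤ.+ k)     = refl
    fromℤ-signed ℤ.-[1+ k ]  = refl

    signed-* : ∀ s t a b → signed s a * signed t b ≡ signed (s Sign.* t) (a * b)
    signed-* Sign.+ Sign.+ a b = refl
    signed-* Sign.+ Sign.- a b = sym (-‿distribʳ-* a b)
    signed-* Sign.- Sign.+ a b = sym (-‿distribˡ-* a b)
    signed-* Sign.- Sign.- a b = begin
      - a * - b        ≡⟨ -‿distribˡ-* a (- b) ⟨
      - (a * - b)      ≡⟨ cong -_ (-‿distribʳ-* a b) ⟨
      - - (a * b)      ≡⟨ -‿involutive (a * b) ⟩
      a * b            ∎

    fromℤ-* : ∀ x y → fromℤ (x ℤ.* y) ≡ fromℤ x * fromℤ y
    fromℤ-* x y = begin
      fromℤ (x ℤ.* y)                                  ≡⟨ fromℤ-◃ (ℤ.sign x Sign.* ℤ.sign y) _ ⟩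
      signed (ℤ.sign x Sign.* ℤ.sign y) [ ℤ.∣ x ∣ ℕ.* ℤ.∣ y ∣ ]
        ≡⟨ cong (signed (ℤ.sign x Sign.* ℤ.sign y)) ([*] ℤ.∣ x ∣ ℤ.∣ y ∣) ⟩
      signed (ℤ.sign x Sign.* ℤ.sign y) ([ ℤ.∣ x ∣ ] * [ ℤ.∣ y ∣ ])
        ≡⟨ signed-* (ℤ.sign x) (ℤ.sign y) _ _ ⟨
      signed (ℤ.sign x) [ ℤ.∣ x ∣ ] * signed (ℤ.sign y) [ ℤ.∣ y ∣ ]
        ≡⟨ cong₂ _*_ (fromℤ-signed x) (fromℤ-signed y) ⟨
      fromℤ x * fromℤ y                                ∎

    fromℤ-homomorphism : ℤ.+-*-rawRing ACR.-Raw-AlmostCommutative⟶ ACR.fromCommutativeRing ℤₙ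
    fromℤ-homomorphism = record
      { ⟦_⟧ = fromℤ ; +-homo = fromℤ-+ ; *-homo = fromℤ-* ; -‿homo = fromℤ-neg
      ; 0-homo = refl ; 1-homo = refl }

  open import Algebra.Solver.Ring ℤ.+-*-rawRing (ACR.fromCommutativeRing ℤₙ) fromℤ-homomorphism
    (λ i j → map (cong fromℤ) (dec⇒maybe (i ℤ.≟ j)))
    using (Polynomial; solve; _:+_; _:*_; :-_; _:-_; _:=_; con)

  :0 :1 : ∀ {m} → Polynomial m
  :0 = con (ℤ.+ 0)
  :1 = con (ℤ.+ 1)

  [toℕ] : ∀ a → [ toℕ a ] ≡ a
  [toℕ] a = ≡ₘ⇒≡ (toℕ-[] (toℕ a))

  -ₙ≡+- : ∀ a b → _-ₙ_ n a b ≡ a + - b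
  -ₙ≡+- a b = ≡ₘ⇒≡ (trans (toℕ-[] _)
    (sym (trans (toℕ-+ a (- b)) (+-congₘ {toℕ a} refl (toℕ-neg b)))))

  [_]-injective : ∀ {i j} → i < n → j < n → [ i ] ≡ [ j ] → i ≡ j
  [_]-injective {i} {j} i<n j<n eq = begin
    i           ≡⟨ m<n⇒m%n≡m i<n ⟨
    i % n       ≡⟨ toℕ-fromℕ< _ ⟨
    toℕ [ i ]   ≡⟨ cong toℕ eq ⟩
    toℕ [ j ]   ≡⟨ toℕ-fromℕ< _ ⟩
    j % n       ≡⟨ m<n⇒m%n≡m j<n ⟩
    j           ∎

  1#≢0# : 2 ≤ n → 1# ≢ 0#
  1#≢0# 2≤n eq with [_]-injective {1} {0} 2≤n (ℕ.<-≤-trans (s≤s z≤n) 2≤n) eq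
  ... | ()

  2#≢0# : 3 ≤ n → 1# + 1# ≢ 0#
  2#≢0# 3≤n eq with [_]-injective {2} {0} 3≤n (ℕ.<-≤-trans (s≤s z≤n) 3≤n) (trans ([+] 1 1) eq)
  ... | ()

  -≡0⇒≡0 : ∀ {a} → - a ≡ 0# → a ≡ 0#
  -≡0⇒≡0 eq = -‿injective (trans eq (sym -0#≈0#))

  unit-cancel : ∀ {u w a} → u * w ≡ 1# → u * a ≡ 0# → a ≡ 0#
  unit-cancel {u} {w} {a} uw≡1 ua≡0 = begin
    a              ≡⟨ *-identityˡ a ⟨
    1# * a         ≡⟨ cong (_* a) (trans (*-comm w u) uw≡1) ⟨
    (w * u) * a    ≡⟨ *-assoc w u a ⟩
    w * (u * a)    ≡⟨ cong (w *_) ua≡0 ⟩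
    w * 0#         ≡⟨ zeroʳ w ⟩
    0#             ∎

  -- Lines in G = ℤₙ × ℤₙ

  G : Set
  G = Gn n

  infixl 6 _⊞_ _⊟_
  infixr 7 _·_

  _⊞_ _⊟_ : G → G → G
  _⊞_ = _⊕_ n
  _⊟_ = _⊖_ n

  _·_ : Zn n → G → G
  _·_ = scale n

  𝟎 : G
  𝟎 = (0# , 0#)

  v : Fin 3 → G
  v = vec n

  ⊟-≡ : ∀ a b c d → (a , b) ⊟ (c , d) ≡ (a + - c , b + - d)
  ⊟-≡ a b c d = cong₂ _,_ (-ₙ≡+- a c) (-ₙ≡+- b d)

  ⊞-⊟-cancel : ∀ c x → (c ⊞ x) ⊟ c ≡ x
  ⊞-⊟-cancel (a , b) (c , d) = trans (⊟-≡ _ _ a b) (cong₂ _,_ (cancel a c) (cancel b d))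
    where
    cancel : ∀ a c → a + c + - a ≡ c
    cancel = solve 2 (λ a c → a :+ c :- a := c) refl

  ⊟-⊞-cancel : ∀ c x → c ⊞ (x ⊟ c) ≡ x
  ⊟-⊞-cancel (a , b) (c , d) =
    trans (cong ((a , b) ⊞_) (⊟-≡ c d a b)) (cong₂ _,_ (cancel a c) (cancel b d))
    where
    cancel : ∀ a c → a + (c + - a) ≡ c
    cancel = solve 2 (λ a c → a :+ (c :- a) := c) refl

  ⊞-cancelˡ : ∀ c {x y} → c ⊞ x ≡ c ⊞ y → x ≡ y
  ⊞-cancelˡ c {x} {y} eq = trans (sym (⊞-⊟-cancel c x)) (trans (cong (_⊟ c) eq) (⊞-⊟-cancel c y))

  ⊟-self : ∀ x → x ⊟ x ≡ 𝟎
  ⊟-self (a , b) = trans (⊟-≡ a b a b) (cong₂ _,_ (-‿inverseʳ a) (-‿inverseʳ b))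

  ⊞-identityʳ : ∀ x → x ⊞ 𝟎 ≡ x
  ⊞-identityʳ (a , b) = cong₂ _,_ (+-identityʳ a) (+-identityʳ b)

  ⊟≡𝟎⇒≡ : ∀ {x y} → x ⊟ y ≡ 𝟎 → x ≡ y
  ⊟≡𝟎⇒≡ {x} {y} eq = trans (sym (⊟-⊞-cancel y x)) (trans (cong (y ⊞_) eq) (⊞-identityʳ y))

  ⊞-assoc : ∀ x y z → (x ⊞ y) ⊞ z ≡ x ⊞ (y ⊞ z)
  ⊞-assoc (a , b) (c , d) (e , f) = cong₂ _,_ (+-assoc a c e) (+-assoc b d f)

  ·-distrib-⊞ : ∀ k x y → k · (x ⊞ y) ≡ k · x ⊞ k · y
  ·-distrib-⊞ k (a , b) (c , d) = cong₂ _,_ (*-distribˡ-+ k a c) (*-distribˡ-+ k b d)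

  ·-assoc : ∀ k k′ x → k · (k′ · x) ≡ (k * k′) · x
  ·-assoc k k′ (a , b) = cong₂ _,_ (sym (*-assoc k k′ a)) (sym (*-assoc k k′ b))

  ·-identity : ∀ x → 1# · x ≡ x
  ·-identity (a , b) = cong₂ _,_ (*-identityˡ a) (*-identityˡ b)

  ·-𝟎 : ∀ k → k · 𝟎 ≡ 𝟎
  ·-𝟎 k = cong₂ _,_ (zeroʳ k) (zeroʳ k)

  _≟ᴳ_ : DecidableEquality G
  _≟ᴳ_ = ≡-dec Fin._≟_ Fin._≟_

  -- ℓ t is a linear form whose kernel is spanned by v t: the lines of class t are its fibres.
  ℓ : Fin 3 → G → Zn n
  ℓ 0F (a , b) = b
  ℓ 1F (a , b) = a
  ℓ 2F (a , b) = a + - b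

  ℓ-⊞ : ∀ t x y → ℓ t (x ⊞ y) ≡ ℓ t x + ℓ t y
  ℓ-⊞ 0F (a , b) (c , d) = refl
  ℓ-⊞ 1F (a , b) (c , d) = refl
  ℓ-⊞ 2F (a , b) (c , d) = solve 4 (λ a b c d → a :+ c :- (b :+ d) := a :- b :+ (c :- d)) refl a b c d

  ℓ-· : ∀ t k x → ℓ t (k · x) ≡ k * ℓ t x
  ℓ-· 0F k (a , b) = refl
  ℓ-· 1F k (a , b) = refl
  ℓ-· 2F k (a , b) = solve 3 (λ k a b → k :* a :- k :* b := k :* (a :- b)) refl k a b

  ℓ-⊞· : ∀ t x k p → ℓ t (x ⊞ k · p) ≡ ℓ t x + k * ℓ t p
  ℓ-⊞· t x k p = trans (ℓ-⊞ t x (k · p)) (cong (ℓ t x +_) (ℓ-· t k p))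

  ℓ-⊟ : ∀ t x y → ℓ t (x ⊟ y) ≡ ℓ t x + - ℓ t y
  ℓ-⊟ t (a , b) (c , d) rewrite ⊟-≡ a b c d with t
  ... | 0F = refl
  ... | 1F = refl
  ... | 2F = solve 4 (λ a b c d → a :- c :- (b :- d) := a :- b :- (c :- d)) refl a b c d

  ℓ-⊟-cong : ∀ t {x y} c → ℓ t x ≡ ℓ t y → ℓ t (x ⊟ c) ≡ ℓ t (y ⊟ c)
  ℓ-⊟-cong t {x} {y} c x≡ₜy =
    trans (ℓ-⊟ t x c) (trans (cong (_+ - ℓ t c) x≡ₜy) (sym (ℓ-⊟ t y c)))

  ℓ-𝟎 : ∀ t → ℓ t 𝟎 ≡ 0#
  ℓ-𝟎 0F = refl
  ℓ-𝟎 1F = refl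
  ℓ-𝟎 2F = -‿inverseʳ 0#

  ℓ-v : ∀ t → ℓ t (v t) ≡ 0#
  ℓ-v 0F = refl
  ℓ-v 1F = refl
  ℓ-v 2F = -‿inverseʳ (- 1#)

  ℓ-along : ∀ t x k → ℓ t (x ⊞ k · v t) ≡ ℓ t x
  ℓ-along t x k = begin
    ℓ t (x ⊞ k · v t)      ≡⟨ ℓ-⊞· t x k (v t) ⟩
    ℓ t x + k * ℓ t (v t)  ≡⟨ cong (λ z → ℓ t x + k * z) (ℓ-v t) ⟩
    ℓ t x + k * 0#         ≡⟨ cong (ℓ t x +_) (zeroʳ k) ⟩
    ℓ t x + 0#             ≡⟨ +-identityʳ (ℓ t x) ⟩
    ℓ t x                  ∎

  ℓ-subst : ∀ {u u′ a b} → u ≡ u′ → ℓ u a ≡ ℓ u b → ℓ u′ a ≡ ℓ u′ b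
  ℓ-subst {a = a} {b} = subst (λ u → ℓ u a ≡ ℓ u b)

  ℓ-fibre : ∀ t {x y} → ℓ t x ≡ ℓ t y → ∃ λ k → y ≡ x ⊞ k · v t
  ℓ-fibre 0F {a , b} {c , d} refl = c + - a , cong₂ _,_
    (solve 2 (λ a c → c := a :+ (c :- a) :* :1) refl a c)
    (solve 3 (λ a b c → b := b :+ (c :- a) :* :0) refl a b c)
  ℓ-fibre 1F {a , b} {c , d} refl = d + - b , cong₂ _,_
    (solve 3 (λ a b d → a := a :+ (d :- b) :* :0) refl a b d)
    (solve 2 (λ b d → d := b :+ (d :- b) :* :1) refl b d)
  ℓ-fibre 2F {a , b} {c , d} eq = a + - c , cong₂ _,_
    (solve 2 (λ a c → c := a :+ (a :- c) :* :- :1) refl a c)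
    (x∙y⁻¹≈ε⇒x≈y d _ (trans
      (solve 4 (λ a b c d → d :- (b :+ (a :- c) :* :- :1) := a :- b :- (c :- d)) refl a b c d)
      (x≈y⇒x∙y⁻¹≈ε eq)))

  v-sum : ∀ {a b} → a ≢ b → v a ⊞ v b ⊞ v (third a b) ≡ 𝟎
  v-sum {0F} {0F} a≢b = ⊥-elim (a≢b refl)
  v-sum {1F} {1F} a≢b = ⊥-elim (a≢b refl)
  v-sum {2F} {2F} a≢b = ⊥-elim (a≢b refl)
  v-sum {0F} {1F} _ = cong₂ _,_ (solve 0 (:1 :+ :0 :- :1 := :0) refl) (solve 0 (:0 :+ :1 :- :1 := :0) refl)
  v-sum {0F} {2F} _ = cong₂ _,_ (solve 0 (:1 :- :1 :+ :0 := :0) refl) (solve 0 (:0 :- :1 :+ :1 := :0) refl)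
  v-sum {1F} {0F} _ = cong₂ _,_ (solve 0 (:0 :+ :1 :- :1 := :0) refl) (solve 0 (:1 :+ :0 :- :1 := :0) refl)
  v-sum {1F} {2F} _ = cong₂ _,_ (solve 0 (:0 :- :1 :+ :1 := :0) refl) (solve 0 (:1 :- :1 :+ :0 := :0) refl)
  v-sum {2F} {0F} _ = cong₂ _,_ (solve 0 (:- :1 :+ :1 :+ :0 := :0) refl) (solve 0 (:- :1 :+ :0 :+ :1 := :0) refl)
  v-sum {2F} {1F} _ = cong₂ _,_ (solve 0 (:- :1 :+ :0 :+ :1 := :0) refl) (solve 0 (:- :1 :+ :1 :+ :0 := :0) refl)

  ℓ-v-pair : ∀ {t s} → t ≢ s → ℓ (third t s) (v t) + ℓ (third t s) (v s) ≡ 0#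
  ℓ-v-pair {t} {s} t≢s = begin
    ℓ r (v t) + ℓ r (v s)                ≡⟨ +-identityʳ _ ⟨
    ℓ r (v t) + ℓ r (v s) + 0#           ≡⟨ cong (ℓ r (v t) + ℓ r (v s) +_) (ℓ-v r) ⟨
    ℓ r (v t) + ℓ r (v s) + ℓ r (v r)    ≡⟨ trans (ℓ-⊞ r (v t ⊞ v s) (v r))
                                                  (cong (_+ ℓ r (v r)) (ℓ-⊞ r (v t) (v s))) ⟨
    ℓ r (v t ⊞ v s ⊞ v r)                ≡⟨ cong (ℓ r) (v-sum t≢s) ⟩
    ℓ r 𝟎                                ≡⟨ ℓ-𝟎 r ⟩
    0#                                   ∎
    where
    r : Fin 3
    r = third t s

  -- The point x ⊞ (- k) · v s of the s-line through x lies on the r-line through x ⊞ k · v t,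
  -- where r = third t s, because v t ⊞ v s ⊞ v r ≡ 𝟎.
  ℓ-corner : ∀ {t s} → t ≢ s → ∀ x k →
             ℓ (third t s) (x ⊞ (- k) · v s) ≡ ℓ (third t s) (x ⊞ k · v t)
  ℓ-corner {t} {s} t≢s x k = begin
    ℓ r (x ⊞ (- k) · v s)              ≡⟨ ℓ-⊞· r x (- k) (v s) ⟩
    ℓ r x + - k * S                   ≡⟨ solve 4 (λ X k T S → X :+ :- k :* S := X :+ k :* T :- k :* (T :+ S))
                                                 refl (ℓ r x) k T S ⟩
    ℓ r x + k * T + - (k * (T + S))    ≡⟨ cong (λ z → ℓ r x + k * T + - (k * z)) (ℓ-v-pair t≢s) ⟩
    ℓ r x + k * T + - (k * 0#)         ≡⟨ solve 3 (λ X k T → X :+ k :* T :- k :* :0 := X :+ k :* T)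
                                                 refl (ℓ r x) k T ⟩
    ℓ r x + k * T                     ≡⟨ ℓ-⊞· r x k (v t) ⟨
    ℓ r (x ⊞ k · v t)                 ∎
    where
    r : Fin 3
    r = third t s
    T S : Zn n
    T = ℓ r (v t)
    S = ℓ r (v s)

  ℓ-v-unit : ∀ {s t} → s ≢ t → ℓ t (v s) ≡ 1# ⊎ ℓ t (v s) ≡ - 1#
  ℓ-v-unit {0F} {0F} s≢t = ⊥-elim (s≢t refl)
  ℓ-v-unit {1F} {1F} s≢t = ⊥-elim (s≢t refl)
  ℓ-v-unit {2F} {2F} s≢t = ⊥-elim (s≢t refl)
  ℓ-v-unit {0F} {1F} _ = inj₁ refl
  ℓ-v-unit {0F} {2F} _ = inj₁ (solve 0 (:1 :- :0 := :1) refl)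
  ℓ-v-unit {1F} {0F} _ = inj₁ refl
  ℓ-v-unit {1F} {2F} _ = inj₂ (solve 0 (:0 :- :1 := :- :1) refl)
  ℓ-v-unit {2F} {0F} _ = inj₂ refl
  ℓ-v-unit {2F} {1F} _ = inj₂ refl

  ℓ-v≢0 : 2 ≤ n → ∀ {s t} → s ≢ t → ℓ t (v s) ≢ 0#
  ℓ-v≢0 2≤n s≢t with ℓ-v-unit s≢t
  ... | inj₁ ≡1  = λ eq → 1#≢0# 2≤n (trans (sym ≡1) eq)
  ... | inj₂ ≡-1 = λ eq → 1#≢0# 2≤n (-≡0⇒≡0 (trans (sym ≡-1) eq))

  ℓ-v-double≢0 : 3 ≤ n → ∀ {s t} → s ≢ t → ℓ t (v s) + ℓ t (v s) ≢ 0#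
  ℓ-v-double≢0 3≤n s≢t with ℓ-v-unit s≢t
  ... | inj₁ ≡1  = λ eq → 2#≢0# 3≤n (trans (sym (cong₂ _+_ ≡1 ≡1)) eq)
  ... | inj₂ ≡-1 = λ eq → 2#≢0# 3≤n
    (-≡0⇒≡0 (trans (sym (-‿+-comm 1# 1#)) (trans (sym (cong₂ _+_ ≡-1 ≡-1)) eq)))

  ·-v-injective : ∀ t {k k′} → k · v t ≡ k′ · v t → k ≡ k′
  ·-v-injective 0F {k} {k′} eq = trans (sym (*-identityʳ k)) (trans (cong proj₁ eq) (*-identityʳ k′))
  ·-v-injective 1F {k} {k′} eq = trans (sym (*-identityʳ k)) (trans (cong proj₂ eq) (*-identityʳ k′))
  ·-v-injective 2F {k} {k′} eq = -‿injective (trans (neg k) (trans (cong proj₁ eq) (sym (neg k′))))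
    where
    neg : ∀ k → - k ≡ k * - 1#
    neg = solve 1 (λ k → :- k := k :* :- :1) refl

  unit-·-v-injective : 2 ≤ n → ∀ {u u′ w′ i j} → u′ * w′ ≡ 1# → u · v i ≡ u′ · v j → i ≡ j
  unit-·-v-injective 2≤n {u} {u′} {w′} {i} {j} u′w′≡1 eq with i Fin.≟ j
  ... | yes i≡j = i≡j
  ... | no i≢j  = ⊥-elim (ℓ-v≢0 2≤n (i≢j ∘ sym) (unit-cancel {u′} {w′} u′w′≡1 (begin
    u′ * ℓ i (v j)     ≡⟨ ℓ-· i u′ (v j) ⟨
    ℓ i (u′ · v j)     ≡⟨ cong (ℓ i) eq ⟨
    ℓ i (u · v i)      ≡⟨ ℓ-· i u (v i) ⟩
    u * ℓ i (v i)      ≡⟨ cong (u *_) (ℓ-v i) ⟩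
    u * 0#             ≡⟨ zeroʳ u ⟩
    0#                 ∎)))

  off-line-step : ∀ {t s} x {k} → k * ℓ t (v s) ≢ 0# → ℓ t x ≢ ℓ t (x ⊞ k · v s)
  off-line-step {t} {s} x {k} k·≢0 on = k·≢0 (+-cancelˡ (ℓ t x) _ _ (begin
    ℓ t x + k * ℓ t (v s)   ≡⟨ ℓ-⊞· t x k (v s) ⟨
    ℓ t (x ⊞ k · v s)       ≡⟨ on ⟨
    ℓ t x                   ≡⟨ +-identityʳ (ℓ t x) ⟨
    ℓ t x + 0#              ∎))

  ℓ-pair-injective : ∀ {s t x y} → s ≢ t → ℓ s x ≡ ℓ s y → ℓ t x ≡ ℓ t y → x ≡ y
  ℓ-pair-injective {0F} {0F} s≢t = ⊥-elim (s≢t refl)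
  ℓ-pair-injective {1F} {1F} s≢t = ⊥-elim (s≢t refl)
  ℓ-pair-injective {2F} {2F} s≢t = ⊥-elim (s≢t refl)
  ℓ-pair-injective {0F} {1F} _ b≡d a≡c = cong₂ _,_ a≡c b≡d
  ℓ-pair-injective {1F} {0F} _ a≡c b≡d = cong₂ _,_ a≡c b≡d
  ℓ-pair-injective {0F} {2F} {a , b} {c , _} _ refl eq = cong (_, b) (+-cancelʳ (- b) a c eq)
  ℓ-pair-injective {2F} {0F} {a , b} {c , _} _ eq refl = cong (_, b) (+-cancelʳ (- b) a c eq)
  ℓ-pair-injective {1F} {2F} {a , b} {_ , d} _ refl eq = cong (a ,_) (-‿injective (+-cancelˡ a (- b) (- d) eq))
  ℓ-pair-injective {2F} {1F} {a , b} {_ , d} _ eq refl = cong (a ,_) (-‿injective (+-cancelˡ a (- b) (- d) eq))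

  common-class-unique : ∀ {s t x y} → x ≢ y → ℓ s x ≡ ℓ s y → ℓ t x ≡ ℓ t y → s ≡ t
  common-class-unique {s} {t} x≢y eqₛ eqₜ with s Fin.≟ t
  ... | yes s≡t = s≡t
  ... | no s≢t = ⊥-elim (x≢y (ℓ-pair-injective s≢t eqₛ eqₜ))

  triangle-third : ∀ {a b c X Y Z} → X ≢ Y → X ≢ Z → a ≢ b →
                   ℓ a X ≡ ℓ a Y → ℓ b X ≡ ℓ b Z → ℓ c Y ≡ ℓ c Z → c ≡ third a b
  triangle-third {a} {b} {c} X≢Y X≢Z a≢b X≡ₐY X≡ᵦZ Y≡꜀Z = ≡third a≢b c≢a c≢b
    where
    c≢a : c ≢ a
    c≢a refl = X≢Z (ℓ-pair-injective a≢b (trans X≡ₐY Y≡꜀Z) X≡ᵦZ)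
    c≢b : c ≢ b
    c≢b refl = X≢Y (ℓ-pair-injective (a≢b ∘ sym) (trans X≡ᵦZ (sym Y≡꜀Z)) X≡ₐY)

  line-avoids : 4 ≤ n → ∀ t x a b c → ∃ λ z → ℓ t z ≡ ℓ t x × z ≢ a × z ≢ b × z ≢ c
  line-avoids 4≤n t x a b c = point i , ℓ-along t x (Fin.inject≤ i 4≤n) , avoids 0F , avoids 1F , avoids 2F
    where
    point : Fin 4 → G
    point i = x ⊞ Fin.inject≤ i 4≤n · v t
    point-injective : Injective _≡_ _≡_ point
    point-injective eq = inject≤-injective _ _ _ _ (·-v-injective t (⊞-cancelˡ x eq))
    given : Fin 3 → G
    given 0F = a
    given 1F = b
    given 2F = c
    found : ∃ λ i → ∀ j → point i ≢ given j
    found = injective⇒avoids _≟ᴳ_ point point-injective given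
    i : Fin 4
    i = proj₁ found
    avoids : ∀ j → point i ≢ given j
    avoids = proj₂ found

  lines-preserving⇒scalar : ∀ (g : G → G) → g 𝟎 ≡ 𝟎 →
                            (∀ t {x z} → ℓ t x ≡ ℓ t z → ℓ t (g x) ≡ ℓ t (g z)) →
                            ∀ x → g x ≡ proj₁ (g (1# , 0#)) · x
  lines-preserving⇒scalar g g𝟎≡𝟎 g-lines (a , b) =
    cong₂ _,_ (trans (g₁ a b) (trans (α-linear a) (*-comm a u)))
              (trans (g₂ a b) (trans (sym (α≡β b)) (trans (α-linear b) (*-comm b u))))
    where
    α β : Zn n → Zn n
    α a = proj₁ (g (a , 0#))
    β b = proj₂ (g (0# , b))
    u : Zn n
    u = α 1#
    g₁ : ∀ a b → proj₁ (g (a , b)) ≡ α a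
    g₁ a b = g-lines 1F refl
    g₂ : ∀ a b → proj₂ (g (a , b)) ≡ β b
    g₂ a b = g-lines 0F refl
    ℓ₂-g : ∀ a b → ℓ 2F (g (a , b)) ≡ α a + - β b
    ℓ₂-g a b = cong₂ (λ p q → p + - q) (g₁ a b) (g₂ a b)
    α≡β : ∀ b → α b ≡ β b
    α≡β b = x∙y⁻¹≈ε⇒x≈y _ _ (begin
      α b + - β b         ≡⟨ ℓ₂-g b b ⟨
      ℓ 2F (g (b , b))    ≡⟨ g-lines 2F (trans (-‿inverseʳ b) (sym (ℓ-𝟎 2F))) ⟩
      ℓ 2F (g 𝟎)          ≡⟨ cong (ℓ 2F) g𝟎≡𝟎 ⟩
      ℓ 2F 𝟎              ≡⟨ ℓ-𝟎 2F ⟩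
      0#                  ∎)
    α-step : ∀ a → α (a + 1#) ≡ α a + u
    α-step a = begin
      α (a + 1#)                    ≡⟨ solve 2 (λ p q → p := p :- q :+ q) refl _ (β 1#) ⟩
      α (a + 1#) + - β 1# + β 1#    ≡⟨ cong (_+ β 1#) (trans (sym (ℓ₂-g (a + 1#) 1#)) (trans
                                         (g-lines 2F (solve 1 (λ a → a :+ :1 :- :1 := a :- :0) refl a))
                                         (ℓ₂-g a 0#))) ⟩
      α a + - β 0# + β 1#           ≡⟨ cong₂ (λ p q → α a + - p + q)
                                               (cong proj₂ g𝟎≡𝟎) (sym (α≡β 1#)) ⟩
      α a + - 0# + u                ≡⟨ solve 2 (λ p q → p :- :0 :+ q := p :+ q) refl (α a) u ⟩
      α a + u                       ∎
    α-[k] : ∀ k → α [ k ] ≡ [ k ] * u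
    α-[k] zero = trans (cong proj₁ g𝟎≡𝟎) (sym (zeroˡ u))
    α-[k] (suc k) = begin
      α [ suc k ]           ≡⟨ cong α ([suc] k) ⟨
      α ([ k ] + 1#)        ≡⟨ α-step [ k ] ⟩
      α [ k ] + u           ≡⟨ cong (_+ u) (α-[k] k) ⟩
      [ k ] * u + u         ≡⟨ solve 2 (λ x u → x :* u :+ u := (x :+ :1) :* u) refl [ k ] u ⟩
      ([ k ] + 1#) * u      ≡⟨ cong (_* u) ([suc] k) ⟩
      [ suc k ] * u         ∎
    α-linear : ∀ a → α a ≡ a * u
    α-linear a = subst (λ a → α a ≡ a * u) ([toℕ] a) (α-[k] (toℕ a))

  -- Adjacency in Γ(n)

  infix 4 _∼_

  -- Adj packaged as a record, so that the endpoints of an edge can be inferred from it.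
  record _∼_ (x y : G) : Set where
    constructor edge
    field adjacent : Adj n x y
  open _∼_ public

  ℓ-⊟≡0⇔ : ∀ t {x y} → ℓ t (x ⊟ y) ≡ 0# ⇔ ℓ t x ≡ ℓ t y
  ℓ-⊟≡0⇔ t {x} {y} = mk⇔
    (λ eq → x∙y⁻¹≈ε⇒x≈y _ _ (trans (sym (ℓ-⊟ t x y)) eq))
    (λ eq → trans (ℓ-⊟ t x y) (x≈y⇒x∙y⁻¹≈ε eq))

  ≢0#⇔1≤ : ∀ {i} → i ≢ 0# ⇔ 1 ≤ toℕ i
  ≢0#⇔1≤ {i} = mk⇔
    (λ i≢0 → ℕ.n≢0⇒n>0 (λ i≡0 → i≢0 (toℕ-injective (trans i≡0 (sym toℕ-0#)))))
    (λ 1≤i i≡0 → ℕ.<⇒≢ 1≤i (sym (trans (cong toℕ i≡0) toℕ-0#)))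

  InS⇔ : ∀ d → InS n d ⇔ (d ≢ 𝟎 × ∃ λ t → ℓ t d ≡ 0#)
  InS⇔ _ = mk⇔ to from
    where
    to : ∀ {d} → InS n d → d ≢ 𝟎 × ∃ λ t → ℓ t d ≡ 0#
    to (i , 1≤i , inj₁ refl)         = Equivalence.from ≢0#⇔1≤ 1≤i ∘ cong proj₁ , 0F , refl
    to (i , 1≤i , inj₂ (inj₁ refl))  = Equivalence.from ≢0#⇔1≤ 1≤i ∘ cong proj₂ , 1F , refl
    to (i , 1≤i , inj₂ (inj₂ refl))  = Equivalence.from ≢0#⇔1≤ 1≤i ∘ cong proj₁ , 2F , -‿inverseʳ i
    from : ∀ {d} → d ≢ 𝟎 × (∃ λ t → ℓ t d ≡ 0#) → InS n d
    from {a , b} (d≢𝟎 , 0F , refl) =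
      a , Equivalence.to ≢0#⇔1≤ (d≢𝟎 ∘ cong (_, 0#)) , inj₁ refl
    from {a , b} (d≢𝟎 , 1F , refl) =
      b , Equivalence.to ≢0#⇔1≤ (d≢𝟎 ∘ cong (0# ,_)) , inj₂ (inj₁ refl)
    from {a , b} (d≢𝟎 , 2F , eq) with x∙y⁻¹≈ε⇒x≈y a b eq
    ... | refl =
      a , Equivalence.to ≢0#⇔1≤ (λ a≡0 → d≢𝟎 (cong₂ _,_ a≡0 a≡0)) , inj₂ (inj₂ refl)

  ∼⇒≢ : ∀ {x y} → x ∼ y → x ≢ y
  ∼⇒≢ {x} (edge x∼x) refl = proj₁ (Equivalence.to (InS⇔ (x ⊟ x)) x∼x) (⊟-self x)

  ∼⇒collinear : ∀ {x y} → x ∼ y → ∃ λ t → ℓ t x ≡ ℓ t y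
  ∼⇒collinear {x} {y} (edge x∼y) with proj₂ (Equivalence.to (InS⇔ (y ⊟ x)) x∼y)
  ... | t , eq = t , sym (Equivalence.to (ℓ-⊟≡0⇔ t) eq)

  collinear⇒∼ : ∀ t {x y} → x ≢ y → ℓ t x ≡ ℓ t y → x ∼ y
  collinear⇒∼ t {x} {y} x≢y eq = edge (Equivalence.from (InS⇔ (y ⊟ x))
    (x≢y ∘ sym ∘ ⊟≡𝟎⇒≡ , t , Equivalence.from (ℓ-⊟≡0⇔ t) (sym eq)))

  ∼-sym : ∀ {x y} → x ∼ y → y ∼ x
  ∼-sym x∼y with ∼⇒collinear x∼y
  ... | t , eq = collinear⇒∼ t (∼⇒≢ x∼y ∘ sym) (sym eq)

  class : ∀ {x y} → x ∼ y → Fin 3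
  class = proj₁ ∘ ∼⇒collinear

  class-collinear : ∀ {x y} (x∼y : x ∼ y) → ℓ (class x∼y) x ≡ ℓ (class x∼y) y
  class-collinear = proj₂ ∘ ∼⇒collinear

  -- The semidirect product acts by automorphisms

  perm : Sym3 n → G → G
  perm = permAct n

  ⟨$⟩ʳ-injective : ∀ (σ : Sym3 n) → Injective _≡_ _≡_ (σ ⟨$⟩ʳ_)
  ⟨$⟩ʳ-injective σ eq = trans (sym (inverseˡ σ)) (trans (cong (σ ⟨$⟩ˡ_) eq) (inverseˡ σ))

  -- perm σ (a , b) = a · V ⊞ b · W with V = v (σ ⟨$⟩ʳ 0F), W = v (σ ⟨$⟩ʳ 1F): in both coordinates
  -- the identities below are one ring identity in a, b and the coordinates of V and W.
  perm-⊞ : ∀ σ x y → perm σ (x ⊞ y) ≡ perm σ x ⊞ perm σ y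
  perm-⊞ σ (a , b) (c , d) = cong₂ _,_ (linear (proj₁ V) (proj₁ W)) (linear (proj₂ V) (proj₂ W))
    where
    V W : G
    V = v (σ ⟨$⟩ʳ 0F)
    W = v (σ ⟨$⟩ʳ 1F)
    linear : ∀ p q → (a + c) * p + (b + d) * q ≡ (a * p + b * q) + (c * p + d * q)
    linear = solve 6 (λ a b c d p q → (a :+ c) :* p :+ (b :+ d) :* q
                                   := (a :* p :+ b :* q) :+ (c :* p :+ d :* q))
                     refl a b c d

  perm-· : ∀ σ k x → perm σ (k · x) ≡ k · perm σ x
  perm-· σ k (a , b) = cong₂ _,_ (linear (proj₁ V) (proj₁ W)) (linear (proj₂ V) (proj₂ W))
    where
    V W : G
    V = v (σ ⟨$⟩ʳ 0F)
    W = v (σ ⟨$⟩ʳ 1F)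
    linear : ∀ p q → (k * a) * p + (k * b) * q ≡ k * (a * p + b * q)
    linear = solve 5 (λ k a b p q → (k :* a) :* p :+ (k :* b) :* q := k :* (a :* p :+ b :* q)) refl k a b

  perm-𝟎 : ∀ σ → perm σ 𝟎 ≡ 𝟎
  perm-𝟎 σ = begin
    perm σ 𝟎           ≡⟨ cong (perm σ) (·-𝟎 0#) ⟨
    perm σ (0# · 𝟎)    ≡⟨ perm-· σ 0# 𝟎 ⟩
    0# · perm σ 𝟎      ≡⟨ cong₂ _,_ (zeroˡ _) (zeroˡ _) ⟩
    𝟎                  ∎

  perm-v : ∀ σ j → perm σ (v j) ≡ v (σ ⟨$⟩ʳ j)
  perm-v σ 0F = cong₂ _,_ (e₀ (proj₁ V) (proj₁ W)) (e₀ (proj₂ V) (proj₂ W))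
    where
    V W : G
    V = v (σ ⟨$⟩ʳ 0F)
    W = v (σ ⟨$⟩ʳ 1F)
    e₀ : ∀ p q → 1# * p + 0# * q ≡ p
    e₀ = solve 2 (λ p q → :1 :* p :+ :0 :* q := p) refl
  perm-v σ 1F = cong₂ _,_ (e₁ (proj₁ V) (proj₁ W)) (e₁ (proj₂ V) (proj₂ W))
    where
    V W : G
    V = v (σ ⟨$⟩ʳ 0F)
    W = v (σ ⟨$⟩ʳ 1F)
    e₁ : ∀ p q → 0# * p + 1# * q ≡ q
    e₁ = solve 2 (λ p q → :0 :* p :+ :1 :* q := q) refl
  perm-v σ 2F = cong₂ _,_ (e₂ (cong proj₁ sum)) (e₂ (cong proj₂ sum))
    where
    V W : G
    V = v (σ ⟨$⟩ʳ 0F)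
    W = v (σ ⟨$⟩ʳ 1F)
    sum : V ⊞ W ⊞ v (σ ⟨$⟩ʳ 2F) ≡ 𝟎
    sum = trans (cong (λ i → V ⊞ W ⊞ v i) (third-injective (⟨$⟩ʳ-injective σ) {0F} {1F} (λ ())))
                (v-sum ((λ ()) ∘ ⟨$⟩ʳ-injective σ))
    e₂ : ∀ {p q r} → p + q + r ≡ 0# → - 1# * p + - 1# * q ≡ r
    e₂ {p} {q} {r} eq = x∙y⁻¹≈ε⇒x≈y _ _
      (trans (solve 3 (λ p q r → :- :1 :* p :+ :- :1 :* q :- r := :0 :- (p :+ q :+ r)) refl p q r)
             (trans (cong (λ z → 0# + - z) eq) (-‿inverseʳ 0#)))

  perm-∘ : ∀ σ τ x → perm σ (perm τ x) ≡ perm (_∘₃_ n σ τ) x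
  perm-∘ σ τ (a , b) = begin
    perm σ (a · v (τ ⟨$⟩ʳ 0F) ⊞ b · v (τ ⟨$⟩ʳ 1F))
      ≡⟨ perm-⊞ σ (a · v (τ ⟨$⟩ʳ 0F)) (b · v (τ ⟨$⟩ʳ 1F)) ⟩
    perm σ (a · v (τ ⟨$⟩ʳ 0F)) ⊞ perm σ (b · v (τ ⟨$⟩ʳ 1F))
      ≡⟨ cong₂ _⊞_ (trans (perm-· σ a (v (τ ⟨$⟩ʳ 0F))) (cong (a ·_) (perm-v σ (τ ⟨$⟩ʳ 0F))))
                   (trans (perm-· σ b (v (τ ⟨$⟩ʳ 1F))) (cong (b ·_) (perm-v σ (τ ⟨$⟩ʳ 1F)))) ⟩
    perm (_∘₃_ n σ τ) (a , b) ∎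

  perm-cong : ∀ {σ σ′} → (∀ i → σ ⟨$⟩ʳ i ≡ σ′ ⟨$⟩ʳ i) → ∀ x → perm σ x ≡ perm σ′ x
  perm-cong eq (a , b) = cong₂ (λ i j → a · v i ⊞ b · v j) (eq 0F) (eq 1F)

  perm-identity : ∀ {ρ} → (∀ i → ρ ⟨$⟩ʳ i ≡ i) → ∀ x → perm ρ x ≡ x
  perm-identity eq (a , b) = trans (cong₂ (λ i j → a · v i ⊞ b · v j) (eq 0F) (eq 1F)) (cong₂ _,_
    (solve 2 (λ a b → a :* :1 :+ b :* :0 := a) refl a b)
    (solve 2 (λ a b → a :* :0 :+ b :* :1 := b) refl a b))

  perm-inverseˡ : ∀ σ x → perm (flip σ) (perm σ x) ≡ x
  perm-inverseˡ σ x =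
    trans (perm-∘ (flip σ) σ x) (perm-identity {_∘₃_ n (flip σ) σ} (λ _ → inverseˡ σ) x)

  perm-inverseʳ : ∀ σ x → perm σ (perm (flip σ) x) ≡ x
  perm-inverseʳ σ x =
    trans (perm-∘ σ (flip σ) x) (perm-identity {_∘₃_ n σ (flip σ)} (λ _ → inverseʳ σ) x)

  perm-lines : ∀ σ {t x y} → ℓ t x ≡ ℓ t y →
               ℓ (σ ⟨$⟩ʳ t) (perm σ x) ≡ ℓ (σ ⟨$⟩ʳ t) (perm σ y)
  perm-lines σ {t} {x} {y} x≡ₜy = begin
    ℓ s (perm σ x)
      ≡⟨ cong (ℓ s ∘ perm σ) (proj₂ (ℓ-fibre t (sym x≡ₜy))) ⟩
    ℓ s (perm σ (y ⊞ k · v t))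
      ≡⟨ cong (ℓ s) (trans (perm-⊞ σ y (k · v t))
                           (cong (perm σ y ⊞_) (trans (perm-· σ k (v t)) (cong (k ·_) (perm-v σ t))))) ⟩
    ℓ s (perm σ y ⊞ k · v s)
      ≡⟨ ℓ-along s (perm σ y) k ⟩
    ℓ s (perm σ y)
      ∎
    where
    s : Fin 3
    s = σ ⟨$⟩ʳ t
    k : Zn n
    k = proj₁ (ℓ-fibre t (sym x≡ₜy))

  affine : SemiDirect n → G → G
  affine (t , h) x = t ⊞ act n h x

  affine⁻¹ : SemiDirect n → G → G
  affine⁻¹ (t , ((_ , w , _) , σ)) y = w · perm (flip σ) (y ⊟ t)

  permutation-part : SemiDirect n → Sym3 n
  permutation-part (_ , (_ , σ)) = σ

  affine⁻¹-affine : ∀ s x → affine⁻¹ s (affine s x) ≡ x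
  affine⁻¹-affine (t , ((u , w , uw≡1) , σ)) x = begin
    w · perm (flip σ) ((t ⊞ u · perm σ x) ⊟ t)
      ≡⟨ cong (λ y → w · perm (flip σ) y) (⊞-⊟-cancel t _) ⟩
    w · perm (flip σ) (u · perm σ x)
      ≡⟨ cong (w ·_) (perm-· (flip σ) u _) ⟩
    w · (u · perm (flip σ) (perm σ x))
      ≡⟨ ·-assoc w u _ ⟩
    (w * u) · perm (flip σ) (perm σ x)
      ≡⟨ cong₂ _·_ (trans (*-comm w u) uw≡1) (perm-inverseˡ σ x) ⟩
    1# · x
      ≡⟨ ·-identity x ⟩
    x ∎

  affine-affine⁻¹ : ∀ s y → affine s (affine⁻¹ s y) ≡ y
  affine-affine⁻¹ (t , ((u , w , uw≡1) , σ)) y = begin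
    t ⊞ u · perm σ (w · perm (flip σ) (y ⊟ t))
      ≡⟨ cong (λ z → t ⊞ u · z) (perm-· σ w _) ⟩
    t ⊞ u · (w · perm σ (perm (flip σ) (y ⊟ t)))
      ≡⟨ cong (t ⊞_) (·-assoc u w _) ⟩
    t ⊞ (u * w) · perm σ (perm (flip σ) (y ⊟ t))
      ≡⟨ cong (t ⊞_) (cong₂ _·_ uw≡1 (perm-inverseʳ σ _)) ⟩
    t ⊞ 1# · (y ⊟ t)
      ≡⟨ cong (t ⊞_) (·-identity _) ⟩
    t ⊞ (y ⊟ t)
      ≡⟨ ⊟-⊞-cancel t y ⟩
    y ∎

  affine-𝟎 : ∀ s → affine s 𝟎 ≡ proj₁ s
  affine-𝟎 (t , ((u , _) , σ)) = begin
    t ⊞ u · perm σ 𝟎   ≡⟨ cong (λ z → t ⊞ u · z) (perm-𝟎 σ) ⟩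
    t ⊞ u · 𝟎          ≡⟨ cong (t ⊞_) (·-𝟎 u) ⟩
    t ⊞ 𝟎              ≡⟨ ⊞-identityʳ t ⟩
    t                  ∎

  affine-lines : ∀ s {t x y} → ℓ t x ≡ ℓ t y →
                 let r = permutation-part s ⟨$⟩ʳ t in ℓ r (affine s x) ≡ ℓ r (affine s y)
  affine-lines (t₀ , ((u , _) , σ)) {t} {x} {y} x≡ₜy = begin
    ℓ r (t₀ ⊞ u · perm σ x)          ≡⟨ ℓ-⊞· r t₀ u (perm σ x) ⟩
    ℓ r t₀ + u * ℓ r (perm σ x)      ≡⟨ cong (λ z → ℓ r t₀ + u * z) (perm-lines σ x≡ₜy) ⟩
    ℓ r t₀ + u * ℓ r (perm σ y)      ≡⟨ ℓ-⊞· r t₀ u (perm σ y) ⟨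
    ℓ r (t₀ ⊞ u · perm σ y)          ∎
    where
    r : Fin 3
    r = σ ⟨$⟩ʳ t

  affine⁻¹-lines : ∀ s {t x y} → ℓ t x ≡ ℓ t y →
                   let r = flip (permutation-part s) ⟨$⟩ʳ t in ℓ r (affine⁻¹ s x) ≡ ℓ r (affine⁻¹ s y)
  affine⁻¹-lines (t₀ , ((_ , w , _) , σ)) {t} {x} {y} x≡ₜy = begin
    ℓ r (w · perm (flip σ) (x ⊟ t₀))     ≡⟨ ℓ-· r w _ ⟩
    w * ℓ r (perm (flip σ) (x ⊟ t₀))     ≡⟨ cong (w *_) (perm-lines (flip σ) (ℓ-⊟-cong t t₀ x≡ₜy)) ⟩
    w * ℓ r (perm (flip σ) (y ⊟ t₀))     ≡⟨ ℓ-· r w _ ⟨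
    ℓ r (w · perm (flip σ) (y ⊟ t₀))     ∎
    where
    r : Fin 3
    r = flip σ ⟨$⟩ʳ t

  lines-map⇒∼-map : ∀ (F : G → G) → Injective _≡_ _≡_ F → (ρ : Fin 3 → Fin 3) →
                    (∀ {t x y} → ℓ t x ≡ ℓ t y → ℓ (ρ t) (F x) ≡ ℓ (ρ t) (F y)) →
                    ∀ {x y} → x ∼ y → F x ∼ F y
  lines-map⇒∼-map F F-injective ρ F-lines x∼y =
    collinear⇒∼ (ρ (class x∼y)) (∼⇒≢ x∼y ∘ F-injective) (F-lines (class-collinear x∼y))

  toAut : SemiDirect n → Aut n
  toAut s = record
    { fun = affine s ; inv = affine⁻¹ s ; inv-l = affine⁻¹-affine s ; inv-r = affine-affine⁻¹ s
    ; adj-to = λ g h g∼h → adjacent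
        (lines-map⇒∼-map (affine s) affine-injective (σ ⟨$⟩ʳ_) (affine-lines s) (edge {g} {h} g∼h))
    ; adj-from = λ g h g∼h → subst₂ (Adj n) (affine⁻¹-affine s g) (affine⁻¹-affine s h) (adjacent
        (lines-map⇒∼-map (affine⁻¹ s) affine⁻¹-injective (flip σ ⟨$⟩ʳ_) (affine⁻¹-lines s)
                         (edge {affine s g} {affine s h} g∼h))) }
    where
    σ : Sym3 n
    σ = permutation-part s
    affine-injective : Injective _≡_ _≡_ (affine s)
    affine-injective {x} {y} eq =
      trans (sym (affine⁻¹-affine s x)) (trans (cong (affine⁻¹ s) eq) (affine⁻¹-affine s y))
    affine⁻¹-injective : Injective _≡_ _≡_ (affine⁻¹ s)
    affine⁻¹-injective {x} {y} eq =
      trans (sym (affine-affine⁻¹ s x)) (trans (cong (affine s) eq) (affine-affine⁻¹ s y))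

  toAut-cong : ∀ x y → _≈SD_ n x y → _≈Aut_ n (toAut x) (toAut y)
  toAut-cong (t , ((u , _) , σ)) (_ , (_ , σ′)) (refl , refl , σ≗σ′) g =
    cong (λ p → t ⊞ u · p) (perm-cong {σ} {σ′} σ≗σ′ g)

  toAut-homo : ∀ x y g → fun (toAut (_·SD_ n x y)) g ≡ fun (toAut x) (fun (toAut y) g)
  toAut-homo (t , ((u , _ , _) , σ)) (t′ , ((u′ , _ , _) , σ′)) g = sym (begin
    t ⊞ u · perm σ (t′ ⊞ u′ · perm σ′ g)
      ≡⟨ cong (λ p → t ⊞ u · p) (perm-⊞ σ t′ _) ⟩
    t ⊞ u · (perm σ t′ ⊞ perm σ (u′ · perm σ′ g))
      ≡⟨ cong (t ⊞_) (·-distrib-⊞ u _ _) ⟩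
    t ⊞ (u · perm σ t′ ⊞ u · perm σ (u′ · perm σ′ g))
      ≡⟨ cong (λ p → t ⊞ (u · perm σ t′ ⊞ p)) scaled ⟩
    t ⊞ (u · perm σ t′ ⊞ (u * u′) · perm (_∘₃_ n σ σ′) g)
      ≡⟨ ⊞-assoc t _ _ ⟨
    t ⊞ u · perm σ t′ ⊞ (u * u′) · perm (_∘₃_ n σ σ′) g
      ∎)
    where
    scaled : u · perm σ (u′ · perm σ′ g) ≡ (u * u′) · perm (_∘₃_ n σ σ′) g
    scaled = begin
      u · perm σ (u′ · perm σ′ g)           ≡⟨ cong (u ·_) (perm-· σ u′ _) ⟩
      u · (u′ · perm σ (perm σ′ g))         ≡⟨ ·-assoc u u′ _ ⟩
      (u * u′) · perm σ (perm σ′ g)         ≡⟨ cong ((u * u′) ·_) (perm-∘ σ σ′ g) ⟩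
      (u * u′) · perm (_∘₃_ n σ σ′) g       ∎

  toAut-injective : 2 ≤ n → ∀ x y → _≈Aut_ n (toAut x) (toAut y) → _≈SD_ n x y
  toAut-injective 2≤n x@(t , ((u , _) , σ)) y@(t′ , ((u′ , _ , u′w′≡1) , σ′)) same =
    t≡t′ , u≡u′ , σ≗σ′
    where
    t≡t′ : t ≡ t′
    t≡t′ = trans (sym (affine-𝟎 x)) (trans (same 𝟎) (affine-𝟎 y))
    on-v : ∀ j → u · v (σ ⟨$⟩ʳ j) ≡ u′ · v (σ′ ⟨$⟩ʳ j)
    on-v j = ⊞-cancelˡ t (begin
      t ⊞ u · v (σ ⟨$⟩ʳ j)       ≡⟨ cong (λ p → t ⊞ u · p) (perm-v σ j) ⟨
      affine x (v j)             ≡⟨ same (v j) ⟩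
      affine y (v j)             ≡⟨ cong₂ (λ a p → a ⊞ u′ · p) (sym t≡t′) (perm-v σ′ j) ⟩
      t ⊞ u′ · v (σ′ ⟨$⟩ʳ j)     ∎)
    σ₀ : σ ⟨$⟩ʳ 0F ≡ σ′ ⟨$⟩ʳ 0F
    σ₀ = unit-·-v-injective 2≤n {u} {u′} u′w′≡1 (on-v 0F)
    σ₁ : σ ⟨$⟩ʳ 1F ≡ σ′ ⟨$⟩ʳ 1F
    σ₁ = unit-·-v-injective 2≤n {u} {u′} u′w′≡1 (on-v 1F)
    u≡u′ : u ≡ u′
    u≡u′ = ·-v-injective (σ′ ⟨$⟩ʳ 0F) {u} {u′} (trans (cong (λ i → u · v i) (sym σ₀)) (on-v 0F))
    σ≗σ′ : ∀ i → σ ⟨$⟩ʳ i ≡ σ′ ⟨$⟩ʳ i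
    σ≗σ′ 0F = σ₀
    σ≗σ′ 1F = σ₁
    σ≗σ′ 2F = begin
      σ ⟨$⟩ʳ 2F
        ≡⟨ third-injective (⟨$⟩ʳ-injective σ) {0F} {1F} (λ ()) ⟩
      third (σ ⟨$⟩ʳ 0F) (σ ⟨$⟩ʳ 1F)
        ≡⟨ cong₂ third σ₀ σ₁ ⟩
      third (σ′ ⟨$⟩ʳ 0F) (σ′ ⟨$⟩ʳ 1F)
        ≡⟨ third-injective (⟨$⟩ʳ-injective σ′) {0F} {1F} (λ ()) ⟨
      σ′ ⟨$⟩ʳ 2F ∎

  -- Recognising lines in the graph

  HaveCommonNeighbour : G → G → G → Set
  HaveCommonNeighbour x y z = ∃ λ w → x ∼ w × y ∼ w × z ∼ w

  HasIsolatedCommonNeighbour : G → G → Set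
  HasIsolatedCommonNeighbour x y = ∃ λ z → x ∼ z × y ∼ z × ¬ HaveCommonNeighbour x y z

  collinear⇒common-neighbour : 4 ≤ n → ∀ t {x y z} → ℓ t x ≡ ℓ t y → ℓ t x ≡ ℓ t z →
                               HaveCommonNeighbour x y z
  collinear⇒common-neighbour 4≤n t {x} {y} {z} x≡y x≡z =
    let w , w≡x , w≢x , w≢y , w≢z = line-avoids 4≤n t x x y z in
    w , collinear⇒∼ t (w≢x ∘ sym) (sym w≡x)
      , collinear⇒∼ t (w≢y ∘ sym) (trans (sym x≡y) (sym w≡x))
      , collinear⇒∼ t (w≢z ∘ sym) (trans (sym x≡z) (sym w≡x))

  -- z is one of the two common neighbours of the edge x y (of class t) that lie off its line.
  record Corner (t s : Fin 3) (x y z : G) : Set where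
    constructor mkCorner
    field
      s≢t      : s ≢ t
      off-line : ℓ t x ≢ ℓ t z
      x-line   : ℓ s x ≡ ℓ s z
      y-line   : ℓ (third t s) y ≡ ℓ (third t s) z

  module _ {t x y} (x≢y : x ≢ y) (x≡ₜy : ℓ t x ≡ ℓ t y) where

    corner : ∀ {z} → x ∼ z → y ∼ z → ℓ t x ≢ ℓ t z → ∃ λ s → Corner t s x y z
    corner {z} x∼z y∼z off = s , record
      { s≢t = s≢t ; off-line = off ; x-line = class-collinear x∼z
      ; y-line = ℓ-subst (≡third (s≢t ∘ sym) r≢t r≢s) (class-collinear y∼z) }
      where
      s r : Fin 3
      s = class x∼z
      r = class y∼z
      s≢t : s ≢ t
      s≢t s≡t = off (ℓ-subst s≡t (class-collinear x∼z))
      r≢t : r ≢ t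
      r≢t r≡t = off (trans x≡ₜy (ℓ-subst r≡t (class-collinear y∼z)))
      r≢s : r ≢ s
      r≢s r≡s = x≢y (ℓ-pair-injective s≢t
        (trans (class-collinear x∼z) (sym (ℓ-subst r≡s (class-collinear y∼z)))) x≡ₜy)

    corner-∼ˡ : ∀ {s z} → Corner t s x y z → x ∼ z
    corner-∼ˡ {s} (mkCorner _ off x≡z _) = collinear⇒∼ s (off ∘ cong (ℓ t)) x≡z

    corner-∼ʳ : ∀ {s z} → Corner t s x y z → y ∼ z
    corner-∼ʳ {s} (mkCorner _ off _ y≡z) =
      collinear⇒∼ (third t s) (off ∘ trans x≡ₜy ∘ cong (ℓ t)) y≡z

    corner-unique : ∀ {s z w} → Corner t s x y z → Corner t s x y w → z ≡ w
    corner-unique (mkCorner s≢t _ x≡z y≡z) (mkCorner _ _ x≡w y≡w) =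
      ℓ-pair-injective (third-≢ʳ (s≢t ∘ sym) ∘ sym) (trans (sym x≡z) x≡w) (trans (sym y≡z) y≡w)

    online-corner-≁ : ∀ {s z w} → Corner t s x y z → ℓ t x ≡ ℓ t w → w ≢ x → w ≢ y → ¬ z ∼ w
    online-corner-≁ (mkCorner s≢t off x≡z y≡z) x≡w w≢x w≢y z∼w
      with third-cases (s≢t ∘ sym) (class z∼w)
    ... | inj₁ u≡t        = off (trans x≡w (sym (ℓ-subst u≡t (class-collinear z∼w))))
    ... | inj₂ (inj₁ u≡s) = w≢x (ℓ-pair-injective s≢t
                              (trans (sym (ℓ-subst u≡s (class-collinear z∼w))) (sym x≡z)) (sym x≡w))
    ... | inj₂ (inj₂ u≡r) = w≢y (ℓ-pair-injective (third-≢ˡ (s≢t ∘ sym))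
                              (trans (sym (ℓ-subst u≡r (class-collinear z∼w))) (sym y≡z))
                              (trans (sym x≡w) x≡ₜy))

    corners-≁ : ∀ {s z w} → Corner t s x y z → Corner t (third t s) x y w →
                ℓ t z ≢ ℓ t w → ¬ z ∼ w
    corners-≁ {s} (mkCorner s≢t _ x≡z y≡z) (mkCorner _ _ x≡w y≡w) z≢ₜw z∼w
      with third-cases (s≢t ∘ sym) (class z∼w)
    ... | inj₁ u≡t        = z≢ₜw (ℓ-subst u≡t (class-collinear z∼w))
    ... | inj₂ (inj₁ u≡s) = x≢y (ℓ-pair-injective s≢t x≡ₛy x≡ₜy)
      where
      x≡ₛy : ℓ s x ≡ ℓ s y
      x≡ₛy = trans x≡z (trans (ℓ-subst u≡s (class-collinear z∼w))
                              (sym (ℓ-subst (third-involutive (s≢t ∘ sym)) y≡w)))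
    ... | inj₂ (inj₂ u≡r) = x≢y (ℓ-pair-injective (third-≢ˡ (s≢t ∘ sym)) x≡ᵣy x≡ₜy)
      where
      x≡ᵣy : ℓ (third t s) x ≡ ℓ (third t s) y
      x≡ᵣy = trans x≡w (trans (sym (ℓ-subst u≡r (class-collinear z∼w))) (sym y≡z))

    neighbour-corner : ∀ {s z w} → Corner t s x y z → x ∼ w → y ∼ w → z ∼ w →
                       Corner t (third t s) x y w
    neighbour-corner {s} {z} {w} c x∼w y∼w z∼w = at-third (corner x∼w y∼w w-off)
      where
      w-off : ℓ t x ≢ ℓ t w
      w-off x≡ₜw = online-corner-≁ c x≡ₜw (∼⇒≢ x∼w ∘ sym) (∼⇒≢ y∼w ∘ sym) z∼w
      at-third : (∃ λ s′ → Corner t s′ x y w) → Corner t (third t s) x y w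
      at-third (s′ , d) with s′ Fin.≟ s
      ... | yes refl = ⊥-elim (∼⇒≢ z∼w (corner-unique c d))
      ... | no s′≢s  =
        subst (λ u → Corner t u x y w) (≡third (Corner.s≢t c ∘ sym) (Corner.s≢t d) s′≢s) d

    isolated-corner : ∀ {s z₀ z₁} → Corner t s x y z₀ → Corner t (third t s) x y z₁ →
                      ℓ t z₀ ≢ ℓ t z₁ → ¬ HaveCommonNeighbour x y z₀
    isolated-corner c₀ c₁ separated (w , x∼w , y∼w , z₀∼w) with ℓ t x Fin.≟ ℓ t w
    ... | yes x≡ₜw = online-corner-≁ c₀ x≡ₜw (∼⇒≢ x∼w ∘ sym) (∼⇒≢ y∼w ∘ sym) z₀∼w
    ... | no _     = corners-≁ c₀ c₁ separated
                       (subst (_ ∼_) (corner-unique (neighbour-corner c₀ x∼w y∼w z₀∼w) c₁) z₀∼w)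

    isolated⇒collinear : 4 ≤ n → HasIsolatedCommonNeighbour x y →
                         ∀ {z} → x ∼ z → y ∼ z → HaveCommonNeighbour x y z → ℓ t x ≡ ℓ t z
    isolated⇒collinear 4≤n (z₀ , x∼z₀ , y∼z₀ , isolated) {z} x∼z y∼z (w , x∼w , y∼w , z∼w)
      with ℓ t x Fin.≟ ℓ t z
    ... | yes x≡ₜz = x≡ₜz
    ... | no x≢ₜz  = ⊥-elim (isolated (shared (corner x∼z y∼z x≢ₜz) (corner x∼z₀ y∼z₀ z₀-off)))
      where
      z₀-off : ℓ t x ≢ ℓ t z₀
      z₀-off x≡ₜz₀ = isolated (collinear⇒common-neighbour 4≤n t x≡ₜy x≡ₜz₀)
      -- z₀ is one of the two corners z and w, which are adjacent common neighbours.
      shared : (∃ λ s → Corner t s x y z) → (∃ λ s → Corner t s x y z₀) →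
               HaveCommonNeighbour x y z₀
      shared (s , c) (s₀ , c₀) with s₀ Fin.≟ s
      ... | yes refl = w , x∼w , y∼w , subst (_∼ w) (corner-unique c c₀) z∼w
      ... | no s₀≢s  = z , x∼z , y∼z ,
        subst (_∼ z) (corner-unique (neighbour-corner c x∼w y∼w z∼w) c₀′) (∼-sym z∼w)
        where
        c₀′ : Corner t (third t s) x y z₀
        c₀′ = subst (λ u → Corner t u x y z₀)
                    (≡third (Corner.s≢t c ∘ sym) (Corner.s≢t c₀) s₀≢s) c₀

  other-class : (t : Fin 3) → ∃ λ s → t ≢ s
  other-class 0F = 1F , λ ()
  other-class 1F = 0F , λ ()
  other-class 2F = 0F , λ ()

  step : Fin 3 → G → G
  step t x = x ⊞ 1# · v t

  step-≢ : 2 ≤ n → ∀ t x → x ≢ step t x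
  step-≢ 2≤n t x x≡y = off-line-step {s} {t} x {1#} 1·≢0 (cong (ℓ s) x≡y)
    where
    s : Fin 3
    s = proj₁ (other-class t)
    1·≢0 : 1# * ℓ s (v t) ≢ 0#
    1·≢0 eq = ℓ-v≢0 2≤n (proj₂ (other-class t)) (trans (sym (*-identityˡ _)) eq)

  step-∼ : 2 ≤ n → ∀ t x → x ∼ step t x
  step-∼ 2≤n t x = collinear⇒∼ t (step-≢ 2≤n t x) (sym (ℓ-along t x 1#))

  -- The corners of the edge x, x + v t are x - v s and x - v r ({t, s, r} = Fin 3); they lie
  -- on different t-lines because ℓ t (v s) = - ℓ t (v r) = ± 1 and 2 ≢ 0.
  step-isolated : 3 ≤ n → ∀ t x → HasIsolatedCommonNeighbour x (step t x)
  step-isolated 3≤n t x =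
    z₀ , corner-∼ˡ x≢y x≡ₜy c₀ , corner-∼ʳ x≢y x≡ₜy c₀ ,
    isolated-corner x≢y x≡ₜy c₀ c₁ separated
    where
    2≤n : 2 ≤ n
    2≤n = ℕ.≤-trans (ℕ.n≤1+n 2) 3≤n
    s : Fin 3
    s = proj₁ (other-class t)
    t≢s : t ≢ s
    t≢s = proj₂ (other-class t)
    r : Fin 3
    r = third t s
    t≢r : t ≢ r
    t≢r = third-≢ˡ t≢s ∘ sym
    y : G
    y = step t x
    x≢y : x ≢ y
    x≢y = step-≢ 2≤n t x
    x≡ₜy : ℓ t x ≡ ℓ t y
    x≡ₜy = sym (ℓ-along t x 1#)
    z₀ z₁ : G
    z₀ = x ⊞ (- 1#) · v s
    z₁ = x ⊞ (- 1#) · v r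
    off : ∀ {u} → t ≢ u → ℓ t x ≢ ℓ t (x ⊞ (- 1#) · v u)
    off {u} t≢u = off-line-step {t} {u} x { - 1#}
      (λ eq → ℓ-v≢0 2≤n (t≢u ∘ sym) (-≡0⇒≡0 (trans (sym (-1*x≈-x _)) eq)))
    c₀ : Corner t s x y z₀
    c₀ = mkCorner (t≢s ∘ sym) (off t≢s) (sym (ℓ-along s x (- 1#))) (sym (ℓ-corner t≢s x 1#))
    c₁ : Corner t r x y z₁
    c₁ = mkCorner (t≢r ∘ sym) (off t≢r) (sym (ℓ-along r x (- 1#))) (sym (ℓ-corner t≢r x 1#))
    A B : Zn n
    A = ℓ t (v s)
    B = ℓ t (v r)
    separated : ℓ t z₀ ≢ ℓ t z₁
    separated z₀≡ₜz₁ = ℓ-v-double≢0 3≤n (t≢s ∘ sym) (begin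
      A + A   ≡⟨ cong (A +_) A≡B ⟩
      A + B   ≡⟨ subst (λ u → ℓ u (v s) + ℓ u (v r) ≡ 0#) third≡t
                       (ℓ-v-pair (third-≢ʳ t≢s ∘ sym)) ⟩
      0#      ∎)
      where
      third≡t : third s r ≡ t
      third≡t = sym (≡third (third-≢ʳ t≢s ∘ sym) t≢s t≢r)
      A≡B : A ≡ B
      A≡B = -‿injective (begin
        - A              ≡⟨ -1*x≈-x A ⟨
        - 1# * A         ≡⟨ +-cancelˡ (ℓ t x) _ _ (trans (sym (ℓ-⊞· t x (- 1#) (v s)))
                              (trans z₀≡ₜz₁ (ℓ-⊞· t x (- 1#) (v r)))) ⟩
        - 1# * B         ≡⟨ -1*x≈-x B ⟩
        - B              ∎)

  -- Automorphisms permute the parallel classes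

  Aut-inverse : Aut n → Aut n
  Aut-inverse f = record
    { fun = inv f ; inv = fun f ; inv-l = inv-r f ; inv-r = inv-l f
    ; adj-to = λ g h g∼h →
        adj-from f (inv f g) (inv f h) (subst₂ (Adj n) (sym (inv-r f g)) (sym (inv-r f h)) g∼h)
    ; adj-from = λ g h g∼h → subst₂ (Adj n) (inv-r f g) (inv-r f h) (adj-to f (inv f g) (inv f h) g∼h) }

  module _ (f : Aut n) where

    fun-injective : Injective _≡_ _≡_ (fun f)
    fun-injective {x} {y} eq = trans (sym (inv-l f x)) (trans (cong (inv f) eq) (inv-l f y))

    ∼-map : ∀ {x y} → x ∼ y → fun f x ∼ fun f y
    ∼-map (edge x∼y) = edge (adj-to f _ _ x∼y)

    ∼-reflect : ∀ {x w} → fun f x ∼ w → x ∼ inv f w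
    ∼-reflect {x} {w} (edge x∼w) =
      edge (adj-from f x (inv f w) (subst (Adj n (fun f x)) (sym (inv-r f w)) x∼w))

    common-neighbour-map : ∀ {x y z} → HaveCommonNeighbour x y z →
                           HaveCommonNeighbour (fun f x) (fun f y) (fun f z)
    common-neighbour-map (w , x∼w , y∼w , z∼w) = fun f w , ∼-map x∼w , ∼-map y∼w , ∼-map z∼w

    isolated-map : ∀ {x y} → HasIsolatedCommonNeighbour x y →
                   HasIsolatedCommonNeighbour (fun f x) (fun f y)
    isolated-map (z , x∼z , y∼z , isolated) = fun f z , ∼-map x∼z , ∼-map y∼z , isolated′
      where
      isolated′ : ¬ HaveCommonNeighbour _ _ (fun f z)
      isolated′ (w , x∼w , y∼w , z∼w) =
        isolated (inv f w , ∼-reflect x∼w , ∼-reflect y∼w , ∼-reflect z∼w)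

    edge-line-map : 4 ≤ n → ∀ {t x y z} → HasIsolatedCommonNeighbour x y → x ≢ y →
                    ℓ t x ≡ ℓ t y → ℓ t x ≡ ℓ t z →
                    ∀ u → ℓ u (fun f x) ≡ ℓ u (fun f y) → ℓ u (fun f x) ≡ ℓ u (fun f z)
    edge-line-map 4≤n {t} {x} {y} {z} isolated x≢y x≡ₜy x≡ₜz u fx≡ᵤfy with z ≟ᴳ x | z ≟ᴳ y
    ... | yes refl | _        = refl
    ... | no _     | yes refl = fx≡ᵤfy
    ... | no z≢x   | no z≢y   =
      isolated⇒collinear {u} (x≢y ∘ fun-injective) fx≡ᵤfy 4≤n (isolated-map isolated)
        (∼-map (collinear⇒∼ t (z≢x ∘ sym) x≡ₜz))
        (∼-map (collinear⇒∼ t (z≢y ∘ sym) (trans (sym x≡ₜy) x≡ₜz)))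
        (common-neighbour-map (collinear⇒common-neighbour 4≤n t x≡ₜy x≡ₜz))

  module _ (4≤n : 4 ≤ n) (f : Aut n) where

    private
      3≤n : 3 ≤ n
      3≤n = ℕ.≤-trans (ℕ.n≤1+n 3) 4≤n
      2≤n : 2 ≤ n
      2≤n = ℕ.≤-trans (ℕ.n≤1+n 2) 3≤n

    -- π x is the permutation of the classes induced by f at x.
    π : G → Fin 3 → Fin 3
    π x t = class (∼-map f (step-∼ 2≤n t x))

    π-line : ∀ {t x z} → ℓ t x ≡ ℓ t z → ℓ (π x t) (fun f x) ≡ ℓ (π x t) (fun f z)
    π-line {t} {x} x≡ₜz =
      edge-line-map f 4≤n {t} (step-isolated 3≤n t x) (step-≢ 2≤n t x) (sym (ℓ-along t x 1#)) x≡ₜz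
        (π x t) (class-collinear (∼-map f (step-∼ 2≤n t x)))

    π-injective : ∀ x → Injective _≡_ _≡_ (π x)
    π-injective x {s} {t} πs≡πt = common-class-unique (step-≢ 2≤n t x) x≡ₛyₜ (sym (ℓ-along t x 1#))
      where
      fx≡fyₛ : ℓ (π x s) (fun f x) ≡ ℓ (π x s) (fun f (step s x))
      fx≡fyₛ = class-collinear (∼-map f (step-∼ 2≤n s x))
      fx≡fyₜ : ℓ (π x s) (fun f x) ≡ ℓ (π x s) (fun f (step t x))
      fx≡fyₜ = ℓ-subst (sym πs≡πt) (π-line {t} {x} (sym (ℓ-along t x 1#)))
      pulled-back : ℓ s (inv f (fun f x)) ≡ ℓ s (inv f (fun f (step t x)))
      pulled-back = edge-line-map (Aut-inverse f) 4≤n {π x s} (isolated-map f (step-isolated 3≤n s x))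
        (step-≢ 2≤n s x ∘ fun-injective f) fx≡fyₛ fx≡fyₜ s
        (subst₂ (λ a b → ℓ s a ≡ ℓ s b) (sym (inv-l f x)) (sym (inv-l f (step s x)))
                (sym (ℓ-along s x 1#)))
      x≡ₛyₜ : ℓ s x ≡ ℓ s (step t x)
      x≡ₛyₜ = subst₂ (λ a b → ℓ s a ≡ ℓ s b) (inv-l f x) (inv-l f (step t x)) pulled-back

    π-shared : ∀ {t x y} → x ≢ y → ℓ t x ≡ ℓ t y → π x t ≡ π y t
    π-shared {t} {x} {y} x≢y x≡ₜy =
      common-class-unique (x≢y ∘ fun-injective f)
        (π-line {t} {x} x≡ₜy) (sym (π-line {t} {y} (sym x≡ₜy)))

    -- For s ≢ t, the corner z of the edge x y makes x y z a triangle with sides in the classes t, s, r;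
    -- its image is a triangle too, which pins down π y r and then π y s.
    π-off : ∀ {t s x y} → x ≢ y → ℓ t x ≡ ℓ t y → t ≢ s → π x s ≡ π y s
    π-off {t} {s} {x} {y} x≢y x≡ₜy t≢s = begin
      π x s                      ≡⟨ cong (π x) s≡third ⟩
      π x (third t r)            ≡⟨ third-injective (π-injective x) t≢r ⟩
      third (π x t) (π x r)      ≡⟨ cong₂ third (π-shared {t} x≢y x≡ₜy) (trans πx-r (sym πy-r)) ⟩
      third (π y t) (π y r)      ≡⟨ third-injective (π-injective y) t≢r ⟨
      π y (third t r)            ≡⟨ cong (π y) s≡third ⟨
      π y s                      ∎
      where
      r : Fin 3
      r = third t s
      t≢r : t ≢ r
      t≢r = third-≢ˡ t≢s ∘ sym
      s≡third : s ≡ third t r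
      s≡third = sym (third-involutive t≢s)
      k : Zn n
      k = proj₁ (ℓ-fibre t x≡ₜy)
      z : G
      z = x ⊞ (- k) · v s
      x≡ₛz : ℓ s x ≡ ℓ s z
      x≡ₛz = sym (ℓ-along s x (- k))
      y≡ᵣz : ℓ r y ≡ ℓ r z
      y≡ᵣz = trans (cong (ℓ r) (proj₂ (ℓ-fibre t x≡ₜy))) (sym (ℓ-corner t≢s x k))
      x≢z : x ≢ z
      x≢z x≡z =
        x≢y (ℓ-pair-injective (third-≢ˡ t≢s) (sym (trans y≡ᵣz (cong (ℓ r) (sym x≡z)))) x≡ₜy)
      πy-r : π y r ≡ third (π x t) (π x s)
      πy-r = triangle-third (x≢y ∘ fun-injective f) (x≢z ∘ fun-injective f) (t≢s ∘ π-injective x)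
        (π-line {t} {x} x≡ₜy) (π-line {s} {x} x≡ₛz) (π-line {r} {y} y≡ᵣz)
      πx-r : π x r ≡ third (π x t) (π x s)
      πx-r = third-injective (π-injective x) t≢s

    π-collinear : ∀ {t x y} → ℓ t x ≡ ℓ t y → ∀ s → π x s ≡ π y s
    π-collinear {t} {x} {y} x≡ₜy s = by-cases (x ≟ᴳ y) (s Fin.≟ t)
      where
      by-cases : Dec (x ≡ y) → Dec (s ≡ t) → π x s ≡ π y s
      by-cases (yes x≡y) _       = cong (λ z → π z s) x≡y
      by-cases (no x≢y) (yes s≡t) = subst (λ u → π x u ≡ π y u) (sym s≡t) (π-shared {t} x≢y x≡ₜy)
      by-cases (no x≢y) (no s≢t)  = π-off x≢y x≡ₜy (s≢t ∘ sym)

    π-origin : ∀ x s → π x s ≡ π 𝟎 s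
    π-origin (a , b) s =
      trans (π-collinear {1F} {a , b} {a , 0#} refl s) (π-collinear {0F} {a , 0#} {𝟎} refl s)

    line-map : ∀ {t x z} → ℓ t x ≡ ℓ t z → ℓ (π 𝟎 t) (fun f x) ≡ ℓ (π 𝟎 t) (fun f z)
    line-map {t} {x} x≡ₜz = ℓ-subst (π-origin x t) (π-line {t} {x} x≡ₜz)

  -- Every automorphism comes from the semidirect product

  module _ (4≤n : 4 ≤ n) (f : Aut n) where

    private
      σ-spec : Σ (Sym3 n) λ σ → ∀ t → σ ⟨$⟩ʳ t ≡ π 4≤n f 𝟎 t
      σ-spec = injective⇒permutation (π 4≤n f 𝟎) (π-injective 4≤n f 𝟎)
      σ : Sym3 n
      σ = proj₁ σ-spec
      o : G
      o = fun f 𝟎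
      g : G → G
      g x = perm (flip σ) (fun f x ⊟ o)
      g-lines : ∀ t {x z} → ℓ t x ≡ ℓ t z → ℓ t (g x) ≡ ℓ t (g z)
      g-lines t x≡ₜz = ℓ-subst {u′ = t} (inverseˡ σ) (perm-lines (flip σ)
        (ℓ-⊟-cong (σ ⟨$⟩ʳ t) o (ℓ-subst (sym (proj₂ σ-spec t)) (line-map 4≤n f {t} x≡ₜz))))
      g-scalar : ∀ x → g x ≡ proj₁ (g (1# , 0#)) · x
      g-scalar =
        lines-preserving⇒scalar g (trans (cong (perm (flip σ)) (⊟-self o)) (perm-𝟎 (flip σ))) g-lines
      u : Zn n
      u = proj₁ (g (1# , 0#))
      y : G
      y = inv f (o ⊞ perm σ (1# , 0#))
      g-y : g y ≡ (1# , 0#)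
      g-y = trans (cong (λ z → perm (flip σ) (z ⊟ o)) (inv-r f _))
                  (trans (cong (perm (flip σ)) (⊞-⊟-cancel o _)) (perm-inverseˡ σ _))
      u-unit : u * proj₁ y ≡ 1#
      u-unit = trans (sym (cong proj₁ (g-scalar y))) (cong proj₁ g-y)

    toAut-surjective : Σ (SemiDirect n) λ s → _≈Aut_ n (toAut s) f
    toAut-surjective = (o , ((u , proj₁ y , u-unit) , σ)) , λ x → begin
      o ⊞ u · perm σ x      ≡⟨ cong (o ⊞_) (perm-· σ u x) ⟨
      o ⊞ perm σ (u · x)    ≡⟨ cong (λ z → o ⊞ perm σ z) (g-scalar x) ⟨
      o ⊞ perm σ (g x)      ≡⟨ cong (o ⊞_) (perm-inverseʳ σ _) ⟩
      o ⊞ (fun f x ⊟ o)     ≡⟨ ⊟-⊞-cancel o (fun f x) ⟩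
      fun f x               ∎

theorem2p3 : (n : ℕ) .{{_ : NonZero n}} → 4 ≤ n → Aut≅SemiDirect n
theorem2p3 n 4≤n = toAut n , record
  { cong-φ     = toAut-cong n
  ; injective  = toAut-injective n (ℕ.≤-trans (ℕ.m≤m+n 2 2) 4≤n)
  ; surjective = toAut-surjective n 4≤n
  ; homo       = toAut-homo n
  }
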